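{- If $D=(V,A)$ is an acyclic digraph, then $$B_D(-q,y,1)=(-1)^{|V|}y^{|A|}B_D(q,1/y,1).$$ If the underlying graph of $D$ is a forest, then $$B_D(-q,y,z)=(-1)^{|V|}(y+z-1)^{|A|}B_D\!\left(q,\frac{y}{y+z-1},\frac{z}{y+z-1}\right).$$
   Context: Digraphs $D=(V,A)$ are finite, loops and multiple arcs allowed; acyclic means no directed cycle. The $B$-polynomial $B_D(q,y,z)$ is the unique polynomial such that for every positive integer $q$, $B_D(q,y,z)=\sum_{f:V\to\{1,\dots,q\}} y^{\#\{(u,v)\in A: f(v)>f(u)\}} z^{\#\{(u,v)\in A: f(v)<f(u)\}}$. The underlying graph is obtained by forgetting arc directions. -}

module Defs where

open import Data.Nat as ℕ using (ℕ; zero; suc)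
open import Data.Integer as ℤ using (ℤ; +_)
open import Data.Rational using (ℚ; 0ℚ; 1ℚ; _+_; _*_; _/_)
open import Data.Fin as Fin using (Fin; zero; suc; toℕ; inject₁; fromℕ)
open import Data.Fin.Properties using (_<?_)
open import Data.List using (List; []; _∷_; map; foldr; concatMap; allFin)
open import Data.Product using (_×_; _,_; proj₁; proj₂)
open import Data.Sum using (_⊎_)
open import Function.Definitions using (Injective)
open import Relation.Binary.PropositionalEquality using (_≡_)
open import Relation.Binary.Construct.Closure.Transitive using (TransClosure)
open import Relation.Nullary using (¬_; does)
open import Data.Bool using (if_then_else_)

-- Digraphs with vertex set Fin n and arc set Fin m.
-- Arc i goes from proj₁ (arc i) (tail) to proj₂ (arc i) (head).
-- Loops and multiple arcs are allowed.

Digraph : ℕ → ℕ → Set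
Digraph n m = Fin m → Fin n × Fin n

ArcRel : ∀ {n m} → Digraph n m → Fin n → Fin n → Set
ArcRel {m = m} D u v = Σ' (Fin m) (λ i → D i ≡ (u , v))
  where
  open import Data.Product using () renaming (Σ to Σ')

Acyclic : ∀ {n m} → Digraph n m → Set
Acyclic {n} D = (v : Fin n) → ¬ TransClosure (ArcRel D) v v

Joins : ∀ {n} → Fin n × Fin n → Fin n → Fin n → Set
Joins a u v = (proj₁ a ≡ u × proj₂ a ≡ v) ⊎ (proj₁ a ≡ v × proj₂ a ≡ u)

-- A cycle of length k+1 in the underlying multigraph: distinct vertices
-- vs 0 .. vs k, distinct edges es 0 .. es k, edge es i joining vs i and
-- vs (i+1), and edge es k joining vs k and vs 0.  (Length 1 = loop,
-- length 2 = two parallel edges.)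
record UCycle {n m} (D : Digraph n m) : Set where
  field
    k  : ℕ
    vs : Fin (suc k) → Fin n
    es : Fin (suc k) → Fin m
    vs-inj : Injective _≡_ _≡_ vs
    es-inj : Injective _≡_ _≡_ es
    step   : (i : Fin k) → Joins (D (es (inject₁ i))) (vs (inject₁ i)) (vs (suc i))
    close  : Joins (D (es (fromℕ k))) (vs (fromℕ k)) (vs zero)

UnderlyingForest : ∀ {n m} → Digraph n m → Set
UnderlyingForest D = ¬ UCycle D

pow : ℚ → ℕ → ℚ
pow x zero    = 1ℚ
pow x (suc k) = x * pow x k

sumℚ : List ℚ → ℚ
sumℚ = foldr _+_ 0ℚ

count : ∀ {m} → (Fin m → Data.Bool.Bool) → ℕ
count {zero}  p = 0
count {suc m} p = (if p zero then 1 else 0) ℕ.+ count (λ i → p (suc i))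

allFuns : (n q : ℕ) → List (Fin n → Fin q)
allFuns zero    q = (λ ()) ∷ []
allFuns (suc n) q =
  concatMap (λ a → map (λ f → λ { zero → a ; (suc i) → f i }) (allFuns n q)) (allFin q)

ascents : ∀ {n m q} → Digraph n m → (Fin n → Fin q) → ℕ
ascents D f = count (λ i → does (f (proj₁ (D i)) <? f (proj₂ (D i))))

descents : ∀ {n m q} → Digraph n m → (Fin n → Fin q) → ℕ
descents D f = count (λ i → does (f (proj₂ (D i)) <? f (proj₁ (D i))))

Bsum : ∀ {n m} → Digraph n m → ℕ → ℚ → ℚ → ℚ
Bsum {n} D q y z =
  sumℚ (map (λ f → pow y (ascents D f) * pow z (descents D f)) (allFuns n q))

-- Polynomials in three variables (q, y, z) with rational coefficients,
-- as a finite list of monomials  c · q^a y^b z^c.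

Poly3 : Set
Poly3 = List (ℚ × ℕ × ℕ × ℕ)

eval3 : Poly3 → ℚ → ℚ → ℚ → ℚ
eval3 P q y z =
  sumℚ (map (λ { (c , a , b , e) → c * (pow q a * (pow y b * pow z e)) }) P)

ℕ→ℚ : ℕ → ℚ
ℕ→ℚ k = (+ k) / 1

-- P is (a representation of) the B-polynomial of D: it agrees with the
-- defining sum for every positive integer q and all y, z.
IsBPoly : ∀ {n m} → Digraph n m → Poly3 → Set
IsBPoly D P = (q : ℕ) → 1 ℕ.≤ q → (y z : ℚ) → eval3 P (ℕ→ℚ q) y z ≡ Bsum D q y z

-- For U ⊆ V let Z U q be the weighted number of q-colourings of D[U], an
-- arc weighing up, flat or down according as its colour ascends, stays or
-- descends.  Peeling off the class M of the largest colour gives the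
-- recursion Z U (q+1) = Σ_{M ⊆ U} t(U,M) Z(U∖M, q), unitriangular in |U|,
-- so Newton interpolation makes q ↦ Z U q a polynomial obeying the
-- recursion at every rational q.  Solving it backwards from q = 0 shows
-- that (-1)^|U| Z U (-q) satisfies the recursion of the inverse kernel.
-- For the weights (y, 1, 1) of an acyclic D this inverse is the kernel of
-- the colourings weighted (1, y, y) peeled at their smallest colour, and
-- for the weights (y, 1, z) of a forest it is the kernel of the colourings
-- weighted (y, y+z-1, z) peeled at their largest colour; up to scaling all
-- weights by y, resp. y+z-1, these are the sums B_D(q, 1/y, 1), resp.
-- B_D(q, y/(y+z-1), z/(y+z-1)).  The inversion formula is proved by
-- expanding the product over the arcs and toggling a vertex that no arc
-- picked: if there were none, the picked arcs would close a directed cycle,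
-- resp. a cycle of the underlying graph.

module Submission where

open import Algebra.Solver.Ring.AlmostCommutativeRing using (fromCommutativeRing; _-Raw-AlmostCommutative⟶_)
import Algebra.Solver.Ring
open import Data.Bool using (Bool; true; false; not; if_then_else_)
import Data.Bool.Properties as BoolP
open import Data.Empty using (⊥-elim)
open import Data.Fin as Fin using (Fin; zero; suc; toℕ; inject₁; fromℕ; fromℕ<; inject)
import Data.Fin.Properties as FinP
open import Data.Fin.Subset using (Subset)
import Data.Integer as ℤ
import Data.Integer.Properties as ℤP
open import Data.List as L using (List; []; _∷_; _++_; concatMap; length)
open import Data.List.Membership.Propositional using (_∈_)
open import Data.List.Membership.Propositional.Properties using (∈-map⁻)
open import Data.List.Properties using (map-tabulate)
open import Data.List.Relation.Unary.Any using (here; there)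
open import Data.Maybe as Maybe using (Maybe; just; nothing)
import Data.Maybe.Properties as MaybeP
open import Data.Nat as ℕ using (ℕ; zero; suc; _≤_; _<_; _∸_; z≤n; s≤s; _<ᵇ_)
import Data.Nat.Properties as ℕP
open import Data.Product using (Σ; ∃; ∃₂; _×_; _,_; proj₁; proj₂)
open import Data.Rational using (ℚ; 0ℚ; 1ℚ; _+_; _*_; -_; _-_; 1/_; _÷_; NonZero; ≢-nonZero; toℚᵘ; fromℚᵘ)
open import Data.Rational.Properties
open import Algebra.Properties.CommutativeMonoid.Sum *-1-commutativeMonoid
  using () renaming (sum to ∏; sum-cong-≗ to ∏-cong; ∑-distrib-+ to ∏-distrib-*)
import Data.Rational.Unnormalised as ℚᵘ
import Data.Rational.Unnormalised.Properties as ℚᵘP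
open import Data.Sum using (_⊎_; inj₁; inj₂; [_,_]′)
open import Data.Vec as V using (Vec; []; _∷_; lookup; replicate; updateAt)
open import Data.Vec.Properties using (lookup-map; lookup-zipWith; lookup-replicate; lookup∘updateAt′)
open import Data.Vec.Relation.Binary.Pointwise.Inductive as Pointwise using (Pointwise; []; _∷_)
open import Function using (_∘_; id)
open import Relation.Binary.Construct.Closure.Transitive using (TransClosure; [_]; _∷_)
open import Relation.Binary.Definitions using (tri<; tri≈; tri>)
open import Relation.Binary.PropositionalEquality
open import Relation.Nullary using (¬_; yes; no; does)
import Relation.Nullary.Decidable as Dec
open import Defs

open ≡-Reasoning

-- A ring solver for ℚ with integer coefficients: normalising coefficients
-- during type checking then computes in ℤ, which is much cheaper than the
-- gcd normalisation of rationals done by Data.Rational.Solver.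

ℤ→ℚ : ℤ.ℤ → ℚ
ℤ→ℚ i = fromℚᵘ (ℚᵘ.mkℚᵘ i 0)

private
  toℚᵘ-ℤ→ℚ : ∀ i → toℚᵘ (ℤ→ℚ i) ℚᵘ.≃ ℚᵘ.mkℚᵘ i 0
  toℚᵘ-ℤ→ℚ i = toℚᵘ-fromℚᵘ (ℚᵘ.mkℚᵘ i 0)

  ℤ→ℚ-homo : ∀ {f : ℤ.ℤ → ℤ.ℤ → ℤ.ℤ} {g : ℚ → ℚ → ℚ} {gᵘ : ℚᵘ.ℚᵘ → ℚᵘ.ℚᵘ → ℚᵘ.ℚᵘ} →
             (∀ p q → toℚᵘ (g p q) ℚᵘ.≃ gᵘ (toℚᵘ p) (toℚᵘ q)) →
             (∀ {p p' q q'} → p ℚᵘ.≃ p' → q ℚᵘ.≃ q' → gᵘ p q ℚᵘ.≃ gᵘ p' q') →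
             (∀ a b → ℚᵘ.mkℚᵘ (f a b) 0 ℚᵘ.≃ gᵘ (ℚᵘ.mkℚᵘ a 0) (ℚᵘ.mkℚᵘ b 0)) →
             ∀ a b → ℤ→ℚ (f a b) ≡ g (ℤ→ℚ a) (ℤ→ℚ b)
  ℤ→ℚ-homo homo cong-ᵘ onIntegers a b = toℚᵘ-injective
    (ℚᵘP.≃-trans (toℚᵘ-ℤ→ℚ _) (ℚᵘP.≃-trans (onIntegers a b)
    (ℚᵘP.≃-sym (ℚᵘP.≃-trans (homo (ℤ→ℚ a) (ℤ→ℚ b)) (cong-ᵘ (toℚᵘ-ℤ→ℚ a) (toℚᵘ-ℤ→ℚ b))))))

  ×1 : ∀ a → a ℤ.* ℤ.1ℤ ≡ a
  ×1 = ℤP.*-identityʳ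

ℤ→ℚ-morphism : ℤ.+-*-rawRing -Raw-AlmostCommutative⟶ fromCommutativeRing +-*-commutativeRing
ℤ→ℚ-morphism = record
  { ⟦_⟧    = ℤ→ℚ
  ; +-homo = ℤ→ℚ-homo {ℤ._+_} {_+_} {ℚᵘ._+_} toℚᵘ-homo-+ ℚᵘP.+-cong (λ a b → ℚᵘ.*≡*
               (trans (×1 _) (trans (cong₂ ℤ._+_ (sym (×1 a)) (sym (×1 b))) (sym (×1 _)))))
  ; *-homo = ℤ→ℚ-homo {ℤ._*_} {_*_} {ℚᵘ._*_} toℚᵘ-homo-* ℚᵘP.*-cong (λ a b → ℚᵘ.*≡* refl)
  ; -‿homo = λ a → toℚᵘ-injective (ℚᵘP.≃-trans (toℚᵘ-ℤ→ℚ (ℤ.- a)) (ℚᵘP.≃-trans (ℚᵘ.*≡* refl)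
               (ℚᵘP.≃-sym (ℚᵘP.≃-trans (toℚᵘ-homo‿- (ℤ→ℚ a)) (ℚᵘP.-‿cong (toℚᵘ-ℤ→ℚ a))))))
  ; 0-homo = refl
  ; 1-homo = refl
  }

ℤ→ℚ-≟ : ∀ a b → Maybe (ℤ→ℚ a ≡ ℤ→ℚ b)
ℤ→ℚ-≟ a b with a ℤ.≟ b
... | yes a≡b = just (cong ℤ→ℚ a≡b)
... | no  _   = nothing

module ℚ-Solver = Algebra.Solver.Ring ℤ.+-*-rawRing (fromCommutativeRing +-*-commutativeRing) ℤ→ℚ-morphism ℤ→ℚ-≟
open ℚ-Solver using (solve; _:+_; _:*_; :-_; _:-_; _:=_; con)

𝟙 𝟘 : ∀ {k} → ℚ-Solver.Polynomial k
𝟙 = con (ℤ.+ 1)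
𝟘 = con (ℤ.+ 0)

ℕ→ℚ≃mkℚᵘ : ∀ k → toℚᵘ (ℕ→ℚ k) ℚᵘ.≃ ℚᵘ.mkℚᵘ (ℤ.+ k) 0
ℕ→ℚ≃mkℚᵘ k = toℚᵘ-fromℚᵘ (ℚᵘ.mkℚᵘ (ℤ.+ k) 0)

ℕ→ℚ-suc : ∀ k → ℕ→ℚ (suc k) ≡ ℕ→ℚ k + 1ℚ
ℕ→ℚ-suc k = toℚᵘ-injective
  (ℚᵘP.≃-trans (ℕ→ℚ≃mkℚᵘ (suc k))
  (ℚᵘP.≃-trans (ℚᵘ.*≡* integer-identity)
  (ℚᵘP.≃-sym (ℚᵘP.≃-trans (toℚᵘ-homo-+ (ℕ→ℚ k) 1ℚ) (ℚᵘP.+-cong (ℕ→ℚ≃mkℚᵘ k) (ℕ→ℚ≃mkℚᵘ 1))))))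
  where
  integer-identity : ℤ.+ suc k ℤ.* ℤ.1ℤ ≡ (ℤ.+ k ℤ.* ℤ.1ℤ ℤ.+ ℤ.1ℤ ℤ.* ℤ.1ℤ) ℤ.* ℤ.1ℤ
  integer-identity = begin
    ℤ.+ suc k ℤ.* ℤ.1ℤ                          ≡⟨ ℤP.*-identityʳ (ℤ.+ suc k) ⟩
    ℤ.+ suc k                                   ≡⟨ cong ℤ.+_ (ℕP.+-comm 1 k) ⟩
    ℤ.+ k ℤ.+ ℤ.1ℤ                              ≡⟨ cong (ℤ._+ ℤ.1ℤ) (sym (ℤP.*-identityʳ (ℤ.+ k))) ⟩
    ℤ.+ k ℤ.* ℤ.1ℤ ℤ.+ ℤ.1ℤ ℤ.* ℤ.1ℤ             ≡⟨ sym (ℤP.*-identityʳ _) ⟩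
    (ℤ.+ k ℤ.* ℤ.1ℤ ℤ.+ ℤ.1ℤ ℤ.* ℤ.1ℤ) ℤ.* ℤ.1ℤ ∎

ℕ→ℚ-injective : ∀ {a b} → ℕ→ℚ a ≡ ℕ→ℚ b → a ≡ b
ℕ→ℚ-injective {a} {b} eq
  with ℚᵘP.≃-trans (ℚᵘP.≃-sym (ℕ→ℚ≃mkℚᵘ a)) (ℚᵘP.≃-trans (toℚᵘ-cong eq) (ℕ→ℚ≃mkℚᵘ b))
... | ℚᵘ.*≡* e = ℤP.+-injective (trans (sym (ℤP.*-identityʳ (ℤ.+ a))) (trans e (ℤP.*-identityʳ (ℤ.+ b))))

ℕ→ℚ-suc-nonZero : ∀ k → NonZero (ℕ→ℚ (suc k))
ℕ→ℚ-suc-nonZero k = ≢-nonZero (λ e → ℕP.0≢1+n (sym (ℕ→ℚ-injective {suc k} {0} e)))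

1/suc : ℕ → ℚ
1/suc k = (1/ ℕ→ℚ (suc k)) {{ℕ→ℚ-suc-nonZero k}}

1/suc-inverse : ∀ k → 1/suc k * ℕ→ℚ (suc k) ≡ 1ℚ
1/suc-inverse k = *-inverseˡ (ℕ→ℚ (suc k)) {{ℕ→ℚ-suc-nonZero k}}

p-q≡0⇒p≡q : ∀ p q → p - q ≡ 0ℚ → p ≡ q
p-q≡0⇒p≡q p q e = begin
  p             ≡⟨ solve 2 (λ p q → p := (p :- q) :+ q) refl p q ⟩
  (p - q) + q   ≡⟨ cong (_+ q) e ⟩
  0ℚ + q        ≡⟨ +-identityˡ q ⟩
  q             ∎

ℕ→ℚ-<⇒-≢0 : ∀ {s k} → s < k → ℕ→ℚ k - ℕ→ℚ s ≢ 0ℚ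
ℕ→ℚ-<⇒-≢0 s<k e = ℕP.<⇒≢ s<k (sym (ℕ→ℚ-injective (p-q≡0⇒p≡q _ _ e)))

p*q≡0⇒p≡0⊎q≡0 : ∀ p q → p * q ≡ 0ℚ → p ≡ 0ℚ ⊎ q ≡ 0ℚ
p*q≡0⇒p≡0⊎q≡0 p q pq≡0 with p ≟ 0ℚ
... | yes p≡0 = inj₁ p≡0
... | no p≢0  = inj₂ (begin
  q                ≡⟨ sym (*-identityˡ q) ⟩
  1ℚ * q           ≡⟨ cong (_* q) (sym (*-inverseˡ p {{≢-nonZero p≢0}})) ⟩
  (p⁻¹ * p) * q    ≡⟨ *-assoc p⁻¹ p q ⟩
  p⁻¹ * (p * q)    ≡⟨ cong (p⁻¹ *_) pq≡0 ⟩
  p⁻¹ * 0ℚ         ≡⟨ *-zeroʳ p⁻¹ ⟩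
  0ℚ               ∎)
  where
  p⁻¹ : ℚ
  p⁻¹ = (1/ p) {{≢-nonZero p≢0}}

p≡-p⇒p≡0 : ∀ p → p ≡ - p → p ≡ 0ℚ
p≡-p⇒p≡0 p p≡-p = [ (λ 2≡0 → ⊥-elim (2≢0 2≡0)) , (λ p≡0 → p≡0) ]′ (p*q≡0⇒p≡0⊎q≡0 (1ℚ + 1ℚ) p 2p≡0)
  where
  2≢0 : 1ℚ + 1ℚ ≢ 0ℚ
  2≢0 ()
  2p≡0 : (1ℚ + 1ℚ) * p ≡ 0ℚ
  2p≡0 = begin
    (1ℚ + 1ℚ) * p   ≡⟨ solve 1 (λ p → (𝟙 :+ 𝟙) :* p := p :- (:- p)) refl p ⟩
    p - (- p)       ≡⟨ cong (λ q → p - q) (sym p≡-p) ⟩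
    p - p           ≡⟨ +-inverseʳ p ⟩
    0ℚ              ∎

pow-1 : ∀ k → pow 1ℚ k ≡ 1ℚ
pow-1 zero    = refl
pow-1 (suc k) = trans (cong (1ℚ *_) (pow-1 k)) (*-identityˡ 1ℚ)

s*e≡w⇒e≡s*w : ∀ s e w → s * s ≡ 1ℚ → s * e ≡ w → e ≡ s * w
s*e≡w⇒e≡s*w s e w s²≡1 se≡w = begin
  e            ≡⟨ sym (*-identityˡ e) ⟩
  1ℚ * e       ≡⟨ cong (_* e) (sym s²≡1) ⟩
  (s * s) * e  ≡⟨ *-assoc s s e ⟩
  s * (s * e)  ≡⟨ cong (s *_) se≡w ⟩
  s * w        ∎

-- Finite sums and products

∑ : {A : Set} → List A → (A → ℚ) → ℚ
∑ xs f = sumℚ (L.map f xs)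

∑ᵛ : {A : Set} {n : ℕ} → Vec (List A) n → (Vec A n → ℚ) → ℚ
∑ᵛ []       F = F []
∑ᵛ (L ∷ Ls) F = ∑ L (λ a → ∑ᵛ Ls (λ v → F (a ∷ v)))

_∈ᵛ_ : {A : Set} {n : ℕ} → Vec A n → Vec (List A) n → Set
v ∈ᵛ Ls = Pointwise _∈_ v Ls

module _ {A : Set} where

  ∑-cong : ∀ (xs : List A) {f g : A → ℚ} → (∀ x → f x ≡ g x) → ∑ xs f ≡ ∑ xs g
  ∑-cong []       f≗g = refl
  ∑-cong (x ∷ xs) f≗g = cong₂ _+_ (f≗g x) (∑-cong xs f≗g)

  ∑-cong∈ : ∀ (xs : List A) {f g : A → ℚ} → (∀ x → x ∈ xs → f x ≡ g x) → ∑ xs f ≡ ∑ xs g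
  ∑-cong∈ []       f≗g = refl
  ∑-cong∈ (x ∷ xs) f≗g = cong₂ _+_ (f≗g x (here refl)) (∑-cong∈ xs (λ y y∈ → f≗g y (there y∈)))

  ∑-++ : ∀ (xs ys : List A) f → ∑ (xs ++ ys) f ≡ ∑ xs f + ∑ ys f
  ∑-++ []       ys f = sym (+-identityˡ _)
  ∑-++ (x ∷ xs) ys f = trans (cong (f x +_) (∑-++ xs ys f)) (sym (+-assoc (f x) (∑ xs f) (∑ ys f)))

  ∑-distrib-+ : ∀ (xs : List A) f g → ∑ xs (λ x → f x + g x) ≡ ∑ xs f + ∑ xs g
  ∑-distrib-+ []       f g = refl
  ∑-distrib-+ (x ∷ xs) f g = trans (cong ((f x + g x) +_) (∑-distrib-+ xs f g))
    (solve 4 (λ a b c d → (a :+ b) :+ (c :+ d) := (a :+ c) :+ (b :+ d)) refl (f x) (g x) (∑ xs f) (∑ xs g))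

  ∑-distribˡ : ∀ (xs : List A) c f → c * ∑ xs f ≡ ∑ xs (λ x → c * f x)
  ∑-distribˡ []       c f = *-zeroʳ c
  ∑-distribˡ (x ∷ xs) c f = trans (*-distribˡ-+ c (f x) _) (cong (c * f x +_) (∑-distribˡ xs c f))

  ∑-zero : ∀ (xs : List A) → ∑ xs (λ _ → 0ℚ) ≡ 0ℚ
  ∑-zero []       = refl
  ∑-zero (x ∷ xs) = trans (+-identityˡ _) (∑-zero xs)

module _ {A B : Set} where

  ∑-map : ∀ (h : A → B) (xs : List A) f → ∑ (L.map h xs) f ≡ ∑ xs (f ∘ h)
  ∑-map h []       f = refl
  ∑-map h (x ∷ xs) f = cong (f (h x) +_) (∑-map h xs f)

  ∑-concatMap : ∀ (g : A → List B) (xs : List A) f → ∑ (concatMap g xs) f ≡ ∑ xs (λ x → ∑ (g x) f)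
  ∑-concatMap g []       f = refl
  ∑-concatMap g (x ∷ xs) f = trans (∑-++ (g x) (concatMap g xs) f) (cong (∑ (g x) f +_) (∑-concatMap g xs f))

  ∑-comm : ∀ (xs : List A) (ys : List B) (f : A → B → ℚ) →
           ∑ xs (λ x → ∑ ys (f x)) ≡ ∑ ys (λ y → ∑ xs (λ x → f x y))
  ∑-comm []       ys f = sym (∑-zero ys)
  ∑-comm (x ∷ xs) ys f = trans (cong (∑ ys (f x) +_) (∑-comm xs ys f))
                               (sym (∑-distrib-+ ys (f x) (λ y → ∑ xs (λ x → f x y))))

∑-tabulate : ∀ {A : Set} {q} (g : Fin q → A) f → ∑ (L.tabulate g) f ≡ ∑ (L.allFin q) (f ∘ g)
∑-tabulate {q = q} g f = trans (cong (λ xs → ∑ xs f) (sym (map-tabulate id g))) (∑-map g (L.allFin q) f)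

∑-allFin-first : ∀ q (f : Fin (suc q) → ℚ) → ∑ (L.allFin (suc q)) f ≡ ∑ (L.allFin q) (f ∘ suc) + f zero
∑-allFin-first q f = trans (cong (f zero +_) (∑-tabulate suc f)) (+-comm (f zero) (∑ (L.allFin q) (f ∘ suc)))

∑-allFin-last : ∀ q (f : Fin (suc q) → ℚ) → ∑ (L.allFin (suc q)) f ≡ ∑ (L.allFin q) (f ∘ inject₁) + f (fromℕ q)
∑-allFin-last q f = trans (∑-tabulate-last q id) (cong (_+ f (fromℕ q)) (∑-tabulate inject₁ f))
  where
  ∑-tabulate-last : ∀ k (g : Fin (suc k) → Fin (suc q)) → ∑ (L.tabulate g) f ≡ ∑ (L.tabulate (g ∘ inject₁)) f + f (g (fromℕ k))
  ∑-tabulate-last zero    g = trans (+-identityʳ (f (g zero))) (sym (+-identityˡ (f (g zero))))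
  ∑-tabulate-last (suc k) g = trans (cong (f (g zero) +_) (∑-tabulate-last k (g ∘ suc)))
    (sym (+-assoc (f (g zero)) (∑ (L.tabulate (g ∘ suc ∘ inject₁)) f) (f (g (suc (fromℕ k))))))

module _ {A : Set} where

  ∑ᵛ-cong : ∀ {n} (Ls : Vec (List A) n) {F G : Vec A n → ℚ} → (∀ v → F v ≡ G v) → ∑ᵛ Ls F ≡ ∑ᵛ Ls G
  ∑ᵛ-cong []       F≗G = F≗G []
  ∑ᵛ-cong (L ∷ Ls) F≗G = ∑-cong L (λ a → ∑ᵛ-cong Ls (λ v → F≗G (a ∷ v)))

  ∑ᵛ-cong∈ : ∀ {n} (Ls : Vec (List A) n) {F G : Vec A n → ℚ} →
             (∀ v → v ∈ᵛ Ls → F v ≡ G v) → ∑ᵛ Ls F ≡ ∑ᵛ Ls G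
  ∑ᵛ-cong∈ []       F≗G = F≗G [] []
  ∑ᵛ-cong∈ (L ∷ Ls) F≗G = ∑-cong∈ L (λ a a∈ → ∑ᵛ-cong∈ Ls (λ v v∈ → F≗G (a ∷ v) (a∈ ∷ v∈)))

  ∑ᵛ-distrib-+ : ∀ {n} (Ls : Vec (List A) n) F G → ∑ᵛ Ls (λ v → F v + G v) ≡ ∑ᵛ Ls F + ∑ᵛ Ls G
  ∑ᵛ-distrib-+ []       F G = refl
  ∑ᵛ-distrib-+ (L ∷ Ls) F G =
    trans (∑-cong L (λ a → ∑ᵛ-distrib-+ Ls (λ v → F (a ∷ v)) (λ v → G (a ∷ v))))
          (∑-distrib-+ L (λ a → ∑ᵛ Ls (λ v → F (a ∷ v))) (λ a → ∑ᵛ Ls (λ v → G (a ∷ v))))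

  ∑ᵛ-distribˡ : ∀ {n} (Ls : Vec (List A) n) c F → c * ∑ᵛ Ls F ≡ ∑ᵛ Ls (λ v → c * F v)
  ∑ᵛ-distribˡ []       c F = refl
  ∑ᵛ-distribˡ (L ∷ Ls) c F = trans (∑-distribˡ L c (λ a → ∑ᵛ Ls (λ v → F (a ∷ v))))
                                   (∑-cong L (λ a → ∑ᵛ-distribˡ Ls c (λ v → F (a ∷ v))))

  ∑ᵛ-zero : ∀ {n} (Ls : Vec (List A) n) → ∑ᵛ Ls (λ _ → 0ℚ) ≡ 0ℚ
  ∑ᵛ-zero []       = refl
  ∑ᵛ-zero (L ∷ Ls) = trans (∑-cong L (λ a → ∑ᵛ-zero Ls)) (∑-zero L)

  ∑ᵛ-neg : ∀ {n} (Ls : Vec (List A) n) F → ∑ᵛ Ls (λ v → - F v) ≡ - ∑ᵛ Ls F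
  ∑ᵛ-neg Ls F = begin
    ∑ᵛ Ls (λ v → - F v)         ≡⟨ ∑ᵛ-cong Ls (λ v → -p≡-1*p (F v)) ⟩
    ∑ᵛ Ls (λ v → - 1ℚ * F v)    ≡⟨ sym (∑ᵛ-distribˡ Ls (- 1ℚ) F) ⟩
    - 1ℚ * ∑ᵛ Ls F              ≡⟨ sym (-p≡-1*p (∑ᵛ Ls F)) ⟩
    - ∑ᵛ Ls F                   ∎
    where
    -p≡-1*p : ∀ p → - p ≡ - 1ℚ * p
    -p≡-1*p = solve 1 (λ p → :- p := :- 𝟙 :* p) refl

  ∑ᵛ-zero∈ : ∀ {n} (Ls : Vec (List A) n) F → (∀ v → v ∈ᵛ Ls → F v ≡ 0ℚ) → ∑ᵛ Ls F ≡ 0ℚ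
  ∑ᵛ-zero∈ Ls F F≡0 = trans (∑ᵛ-cong∈ Ls F≡0) (∑ᵛ-zero Ls)

  ∑ᵛ-updateAt : ∀ {n} (Ls : Vec (List A) n) (i : Fin n) (h : A → A) →
                (∀ f → ∑ (lookup Ls i) f ≡ ∑ (lookup Ls i) (f ∘ h)) →
                ∀ F → ∑ᵛ Ls F ≡ ∑ᵛ Ls (λ v → F (updateAt v i h))
  ∑ᵛ-updateAt (L ∷ Ls) zero    h h-perm F = h-perm (λ a → ∑ᵛ Ls (λ v → F (a ∷ v)))
  ∑ᵛ-updateAt (L ∷ Ls) (suc i) h h-perm F = ∑-cong L (λ a → ∑ᵛ-updateAt Ls i h h-perm (λ v → F (a ∷ v)))

  ∑ᵛ-sign-reversing : ∀ {n} (Ls : Vec (List A) n) (i : Fin n) (h : A → A) →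
                      (∀ f → ∑ (lookup Ls i) f ≡ ∑ (lookup Ls i) (f ∘ h)) →
                      ∀ F → (∀ v → v ∈ᵛ Ls → F (updateAt v i h) ≡ - F v) → ∑ᵛ Ls F ≡ 0ℚ
  ∑ᵛ-sign-reversing Ls i h h-perm F anti = p≡-p⇒p≡0 (∑ᵛ Ls F) (begin
    ∑ᵛ Ls F                           ≡⟨ ∑ᵛ-updateAt Ls i h h-perm F ⟩
    ∑ᵛ Ls (λ v → F (updateAt v i h))  ≡⟨ ∑ᵛ-cong∈ Ls anti ⟩
    ∑ᵛ Ls (λ v → - F v)               ≡⟨ ∑ᵛ-neg Ls F ⟩
    - ∑ᵛ Ls F                         ∎)

module _ {A B : Set} where

  ∑-∑ᵛ-comm : ∀ {n} (xs : List A) (Ls : Vec (List B) n) (G : A → Vec B n → ℚ) →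
              ∑ xs (λ x → ∑ᵛ Ls (G x)) ≡ ∑ᵛ Ls (λ v → ∑ xs (λ x → G x v))
  ∑-∑ᵛ-comm xs []       G = refl
  ∑-∑ᵛ-comm xs (L ∷ Ls) G = trans (∑-comm xs L (λ x a → ∑ᵛ Ls (λ v → G x (a ∷ v))))
                                  (∑-cong L (λ a → ∑-∑ᵛ-comm xs Ls (λ x v → G x (a ∷ v))))

  ∑ᵛ-comm : ∀ {n k} (Ks : Vec (List A) k) (Ls : Vec (List B) n) (G : Vec A k → Vec B n → ℚ) →
            ∑ᵛ Ks (λ u → ∑ᵛ Ls (G u)) ≡ ∑ᵛ Ls (λ v → ∑ᵛ Ks (λ u → G u v))
  ∑ᵛ-comm []       Ls G = refl
  ∑ᵛ-comm (K ∷ Ks) Ls G = trans (∑-cong K (λ a → ∑ᵛ-comm Ks Ls (λ u → G (a ∷ u))))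
                                (∑-∑ᵛ-comm K Ls (λ a v → ∑ᵛ Ks (λ u → G (a ∷ u) v)))

module _ {P A B C : Set} (whole : P → List A) (outer : P → List B) (inner : P → B → List C) (φ : B → C → A)
         (fibres : ∀ p f → ∑ (whole p) f ≡ ∑ (outer p) (λ b → ∑ (inner p b) (f ∘ φ b))) where

  ∑ᵛ-fibres : ∀ {n} (ps : Vec P n) (F : Vec A n → ℚ) →
    ∑ᵛ (V.map whole ps) F ≡
    ∑ᵛ (V.map outer ps) (λ bs → ∑ᵛ (V.zipWith inner ps bs) (λ cs → F (V.zipWith φ bs cs)))
  ∑ᵛ-fibres []       F = refl
  ∑ᵛ-fibres {suc n} (p ∷ ps) F = begin
    ∑ (whole p) (λ a → ∑ᵛ (V.map whole ps) (λ v → F (a ∷ v)))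
      ≡⟨ fibres p (λ a → ∑ᵛ (V.map whole ps) (λ v → F (a ∷ v))) ⟩
    ∑ (outer p) (λ b → ∑ (inner p b) (λ c → ∑ᵛ (V.map whole ps) (λ v → F (φ b c ∷ v))))
      ≡⟨ ∑-cong (outer p) (λ b → ∑-cong (inner p b) (λ c → ∑ᵛ-fibres ps (λ v → F (φ b c ∷ v)))) ⟩
    ∑ (outer p) (λ b → ∑ (inner p b) (λ c → ∑ᵛ (V.map outer ps) (G b c)))
      ≡⟨ ∑-cong (outer p) (λ b → ∑-∑ᵛ-comm (inner p b) (V.map outer ps) (G b)) ⟩
    ∑ (outer p) (λ b → ∑ᵛ (V.map outer ps) (λ bs → ∑ (inner p b) (λ c → G b c bs)))
      ∎
    where
    G : B → C → Vec B n → ℚ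
    G b c bs = ∑ᵛ (V.zipWith inner ps bs) (λ cs → F (φ b c ∷ V.zipWith φ bs cs))

∏-zero : ∀ {m} (f : Fin m → ℚ) (i : Fin m) → f i ≡ 0ℚ → ∏ f ≡ 0ℚ
∏-zero {suc m} f zero    fi≡0 = trans (cong (_* ∏ (f ∘ suc)) fi≡0) (*-zeroˡ (∏ (f ∘ suc)))
∏-zero {suc m} f (suc i) fi≡0 = trans (cong (f zero *_) (∏-zero (f ∘ suc) i fi≡0)) (*-zeroʳ (f zero))

∏-one : ∀ {m} (f : Fin m → ℚ) → (∀ i → f i ≡ 1ℚ) → ∏ f ≡ 1ℚ
∏-one {zero}  f f≡1 = refl
∏-one {suc m} f f≡1 = trans (cong₂ _*_ (f≡1 zero) (∏-one (f ∘ suc) (f≡1 ∘ suc))) (*-identityˡ 1ℚ)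

∏-distrib-∑ : ∀ {J : Set} m (js : List J) (h : Fin m → J → ℚ) →
              ∏ (λ i → ∑ js (h i)) ≡ ∑ᵛ (replicate m js) (λ φ → ∏ (λ i → h i (lookup φ i)))
∏-distrib-∑ zero    js h = refl
∏-distrib-∑ (suc m) js h = begin
  ∑ js (h zero) * ∏ (λ i → ∑ js (h (suc i)))   ≡⟨ cong (∑ js (h zero) *_) (∏-distrib-∑ m js (h ∘ suc)) ⟩
  ∑ js (h zero) * R                           ≡⟨ *-comm (∑ js (h zero)) R ⟩
  R * ∑ js (h zero)                           ≡⟨ ∑-distribˡ js R (h zero) ⟩
  ∑ js (λ j → R * h zero j)                   ≡⟨ ∑-cong js (λ j → trans (*-comm R (h zero j)) (∑ᵛ-distribˡ (replicate m js) (h zero j) _)) ⟩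
  ∑ js (λ j → ∑ᵛ (replicate m js) (λ φ → h zero j * ∏ (λ i → h (suc i) (lookup φ i)))) ∎
  where
  R : ℚ
  R = ∑ᵛ (replicate m js) (λ φ → ∏ (λ i → h (suc i) (lookup φ i)))

-- Polynomials and the identity principle

Poly : Set
Poly = List ℚ

⟦_⟧ : Poly → ℚ → ℚ
⟦ []     ⟧ x = 0ℚ
⟦ c ∷ cs ⟧ x = c + x * ⟦ cs ⟧ x

_+ᴾ_ : Poly → Poly → Poly
[]       +ᴾ qs       = qs
(p ∷ ps) +ᴾ []       = p ∷ ps
(p ∷ ps) +ᴾ (q ∷ qs) = (p + q) ∷ (ps +ᴾ qs)

_*ᴾ_ : Poly → Poly → Poly
[]       *ᴾ qs = []
(p ∷ ps) *ᴾ qs = L.map (p *_) qs +ᴾ (0ℚ ∷ (ps *ᴾ qs))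

⟦+ᴾ⟧ : ∀ ps qs x → ⟦ ps +ᴾ qs ⟧ x ≡ ⟦ ps ⟧ x + ⟦ qs ⟧ x
⟦+ᴾ⟧ []       qs       x = sym (+-identityˡ (⟦ qs ⟧ x))
⟦+ᴾ⟧ (p ∷ ps) []       x = sym (+-identityʳ (p + x * ⟦ ps ⟧ x))
⟦+ᴾ⟧ (p ∷ ps) (q ∷ qs) x = trans (cong (λ z → (p + q) + x * z) (⟦+ᴾ⟧ ps qs x))
  (solve 5 (λ p q x P Q → (p :+ q) :+ x :* (P :+ Q) := (p :+ x :* P) :+ (q :+ x :* Q)) refl p q x (⟦ ps ⟧ x) (⟦ qs ⟧ x))

⟦scale⟧ : ∀ c ps x → ⟦ L.map (c *_) ps ⟧ x ≡ c * ⟦ ps ⟧ x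
⟦scale⟧ c []       x = sym (*-zeroʳ c)
⟦scale⟧ c (p ∷ ps) x = trans (cong (λ z → c * p + x * z) (⟦scale⟧ c ps x))
  (solve 4 (λ c p x P → c :* p :+ x :* (c :* P) := c :* (p :+ x :* P)) refl c p x (⟦ ps ⟧ x))

⟦*ᴾ⟧ : ∀ ps qs x → ⟦ ps *ᴾ qs ⟧ x ≡ ⟦ ps ⟧ x * ⟦ qs ⟧ x
⟦*ᴾ⟧ []       qs x = sym (*-zeroˡ (⟦ qs ⟧ x))
⟦*ᴾ⟧ (p ∷ ps) qs x = begin
  ⟦ L.map (p *_) qs +ᴾ (0ℚ ∷ (ps *ᴾ qs)) ⟧ x     ≡⟨ ⟦+ᴾ⟧ (L.map (p *_) qs) (0ℚ ∷ (ps *ᴾ qs)) x ⟩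
  ⟦ L.map (p *_) qs ⟧ x + (0ℚ + x * ⟦ ps *ᴾ qs ⟧ x)
    ≡⟨ cong₂ (λ u w → u + (0ℚ + x * w)) (⟦scale⟧ p qs x) (⟦*ᴾ⟧ ps qs x) ⟩
  p * Q + (0ℚ + x * (P * Q))                    ≡⟨ solve 4 (λ p x P Q → p :* Q :+ (𝟘 :+ x :* (P :* Q)) := (p :+ x :* P) :* Q) refl p x P Q ⟩
  (p + x * P) * Q                               ∎
  where
  P Q : ℚ
  P = ⟦ ps ⟧ x
  Q = ⟦ qs ⟧ x

IsPolynomial : (ℚ → ℚ) → Set
IsPolynomial f = Σ Poly (λ ps → ∀ x → f x ≡ ⟦ ps ⟧ x)

isPolynomial-const : ∀ c → IsPolynomial (λ _ → c)
isPolynomial-const c = c ∷ [] , λ x → sym (trans (cong (c +_) (*-zeroʳ x)) (+-identityʳ c))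

isPolynomial-id : IsPolynomial (λ x → x)
isPolynomial-id = 0ℚ ∷ 1ℚ ∷ [] , solve 1 (λ x → x := 𝟘 :+ x :* (𝟙 :+ x :* 𝟘)) refl

isPolynomial-cong : ∀ {f g} → (∀ x → f x ≡ g x) → IsPolynomial f → IsPolynomial g
isPolynomial-cong f≗g (ps , f≗ps) = ps , λ x → trans (sym (f≗g x)) (f≗ps x)

isPolynomial-+ : ∀ {f g} → IsPolynomial f → IsPolynomial g → IsPolynomial (λ x → f x + g x)
isPolynomial-+ (ps , f≗ps) (qs , g≗qs) = ps +ᴾ qs , λ x → trans (cong₂ _+_ (f≗ps x) (g≗qs x)) (sym (⟦+ᴾ⟧ ps qs x))

isPolynomial-* : ∀ {f g} → IsPolynomial f → IsPolynomial g → IsPolynomial (λ x → f x * g x)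
isPolynomial-* (ps , f≗ps) (qs , g≗qs) = ps *ᴾ qs , λ x → trans (cong₂ _*_ (f≗ps x) (g≗qs x)) (sym (⟦*ᴾ⟧ ps qs x))

isPolynomial-neg : ∀ {f} → IsPolynomial f → IsPolynomial (λ x → - f x)
isPolynomial-neg {f} pf = isPolynomial-cong (λ x → solve 1 (λ a → :- 𝟙 :* a := :- a) refl (f x))
                                            (isPolynomial-* (isPolynomial-const (- 1ℚ)) pf)

isPolynomial-pow : ∀ {f} → IsPolynomial f → ∀ k → IsPolynomial (λ x → pow (f x) k)
isPolynomial-pow pf zero    = isPolynomial-const 1ℚ
isPolynomial-pow pf (suc k) = isPolynomial-* pf (isPolynomial-pow pf k)

-- Synthetic division of c + x·p(x) by x − r: the quotient does not depend on c.
quotient : ℚ → Poly → Poly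
quotient r []       = []
quotient r (p ∷ ps) = ⟦ p ∷ ps ⟧ r ∷ quotient r ps

length-quotient : ∀ r ps → length (quotient r ps) ≡ length ps
length-quotient r []       = refl
length-quotient r (p ∷ ps) = cong suc (length-quotient r ps)

x*⟦ps⟧-divides : ∀ r ps x → x * ⟦ ps ⟧ x - r * ⟦ ps ⟧ r ≡ (x - r) * ⟦ quotient r ps ⟧ x
x*⟦ps⟧-divides r []       x = solve 2 (λ x r → x :* 𝟘 :- r :* 𝟘 := (x :- r) :* 𝟘) refl x r
x*⟦ps⟧-divides r (p ∷ ps) x = begin
  x * (p + x * Px) - r * (p + r * Pr)              ≡⟨ solve 5 (λ x r p Px Pr → x :* (p :+ x :* Px) :- r :* (p :+ r :* Pr)
                                                                := (x :- r) :* (p :+ r :* Pr) :+ x :* (x :* Px :- r :* Pr)) refl x r p Px Pr ⟩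
  (x - r) * (p + r * Pr) + x * (x * Px - r * Pr)   ≡⟨ cong (λ z → (x - r) * (p + r * Pr) + x * z) (x*⟦ps⟧-divides r ps x) ⟩
  (x - r) * (p + r * Pr) + x * ((x - r) * Q)        ≡⟨ solve 5 (λ x r p Pr Q → (x :- r) :* (p :+ r :* Pr) :+ x :* ((x :- r) :* Q)
                                                                := (x :- r) :* ((p :+ r :* Pr) :+ x :* Q)) refl x r p Pr Q ⟩
  (x - r) * ⟦ quotient r (p ∷ ps) ⟧ x              ∎
  where
  Px Pr Q : ℚ
  Px = ⟦ ps ⟧ x
  Pr = ⟦ ps ⟧ r
  Q  = ⟦ quotient r ps ⟧ x

factor-theorem : ∀ r p ps x → ⟦ p ∷ ps ⟧ x ≡ (x - r) * ⟦ quotient r ps ⟧ x + ⟦ p ∷ ps ⟧ r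
factor-theorem r p ps x = begin
  p + x * ⟦ ps ⟧ x                                   ≡⟨ solve 5 (λ p x r a b → p :+ x :* a := (x :* a :- r :* b) :+ (p :+ r :* b))
                                                        refl p x r (⟦ ps ⟧ x) (⟦ ps ⟧ r) ⟩
  (x * ⟦ ps ⟧ x - r * ⟦ ps ⟧ r) + (p + r * ⟦ ps ⟧ r) ≡⟨ cong (_+ (p + r * ⟦ ps ⟧ r)) (x*⟦ps⟧-divides r ps x) ⟩
  (x - r) * ⟦ quotient r ps ⟧ x + ⟦ p ∷ ps ⟧ r        ∎

vanishing-at-naturals : ∀ N ps → length ps ≡ N → ∀ s → (∀ k → s < k → ⟦ ps ⟧ (ℕ→ℚ k) ≡ 0ℚ) →
                        ∀ x → ⟦ ps ⟧ x ≡ 0ℚ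
vanishing-at-naturals _       []       _   s vanish x = refl
vanishing-at-naturals (suc N) (p ∷ ps) len s vanish x = begin
  ⟦ p ∷ ps ⟧ x                        ≡⟨ factor-theorem r p ps x ⟩
  (x - r) * ⟦ Q ⟧ x + ⟦ p ∷ ps ⟧ r    ≡⟨ cong₂ (λ u w → (x - r) * u + w) Q≡0 (vanish (suc s) ℕP.≤-refl) ⟩
  (x - r) * 0ℚ + 0ℚ                   ≡⟨ trans (+-identityʳ ((x - r) * 0ℚ)) (*-zeroʳ (x - r)) ⟩
  0ℚ                                  ∎
  where
  r : ℚ
  r = ℕ→ℚ (suc s)
  Q : Poly
  Q = quotient r ps
  Q-vanishes : ∀ k → suc s < k → ⟦ Q ⟧ (ℕ→ℚ k) ≡ 0ℚ
  Q-vanishes k s+1<k = [ (λ k-r≡0 → ⊥-elim (ℕ→ℚ-<⇒-≢0 s+1<k k-r≡0)) , (λ Q≡0 → Q≡0) ]′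
    (p*q≡0⇒p≡0⊎q≡0 (ℕ→ℚ k - r) (⟦ Q ⟧ (ℕ→ℚ k)) (begin
      (ℕ→ℚ k - r) * ⟦ Q ⟧ (ℕ→ℚ k)                  ≡⟨ sym (+-identityʳ ((ℕ→ℚ k - r) * ⟦ Q ⟧ (ℕ→ℚ k))) ⟩
      (ℕ→ℚ k - r) * ⟦ Q ⟧ (ℕ→ℚ k) + 0ℚ             ≡⟨ cong ((ℕ→ℚ k - r) * ⟦ Q ⟧ (ℕ→ℚ k) +_) (sym (vanish (suc s) ℕP.≤-refl)) ⟩
      (ℕ→ℚ k - r) * ⟦ Q ⟧ (ℕ→ℚ k) + ⟦ p ∷ ps ⟧ r   ≡⟨ sym (factor-theorem r p ps (ℕ→ℚ k)) ⟩
      ⟦ p ∷ ps ⟧ (ℕ→ℚ k)                            ≡⟨ vanish k (ℕP.<-trans ℕP.≤-refl s+1<k) ⟩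
      0ℚ                                            ∎))
  Q≡0 : ⟦ Q ⟧ x ≡ 0ℚ
  Q≡0 = vanishing-at-naturals N Q (trans (length-quotient r ps) (ℕP.suc-injective len)) (suc s) Q-vanishes x

polynomial-identity : ∀ {f g} → IsPolynomial f → IsPolynomial g →
                      (∀ k → 1 ≤ k → f (ℕ→ℚ k) ≡ g (ℕ→ℚ k)) → ∀ x → f x ≡ g x
polynomial-identity {f} {g} pf pg agree x = p-q≡0⇒p≡q (f x) (g x) (begin
  f x - g x       ≡⟨ f-g≗ds x ⟩
  ⟦ ds ⟧ x        ≡⟨ vanishing-at-naturals (length ds) ds refl 0 ds-vanishes x ⟩
  0ℚ              ∎)
  where
  difference : IsPolynomial (λ x → f x - g x)
  difference = isPolynomial-+ pf (isPolynomial-neg pg)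
  ds : Poly
  ds = proj₁ difference
  f-g≗ds : ∀ x → f x - g x ≡ ⟦ ds ⟧ x
  f-g≗ds = proj₂ difference
  ds-vanishes : ∀ k → 0 < k → ⟦ ds ⟧ (ℕ→ℚ k) ≡ 0ℚ
  ds-vanishes k 0<k = begin
    ⟦ ds ⟧ (ℕ→ℚ k)                 ≡⟨ sym (f-g≗ds (ℕ→ℚ k)) ⟩
    f (ℕ→ℚ k) - g (ℕ→ℚ k)          ≡⟨ cong (_- g (ℕ→ℚ k)) (agree k 0<k) ⟩
    g (ℕ→ℚ k) - g (ℕ→ℚ k)          ≡⟨ +-inverseʳ (g (ℕ→ℚ k)) ⟩
    0ℚ                             ∎

_choose_ : ℚ → ℕ → ℚ
x choose zero  = 1ℚ
x choose suc k = x choose k * ((x - ℕ→ℚ k) * 1/suc k)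

isPolynomial-choose : ∀ k → IsPolynomial (_choose k)
isPolynomial-choose zero    = isPolynomial-const 1ℚ
isPolynomial-choose (suc k) = isPolynomial-* (isPolynomial-choose k)
  (isPolynomial-* (isPolynomial-+ isPolynomial-id (isPolynomial-const (- ℕ→ℚ k))) (isPolynomial-const (1/suc k)))

0-choose-suc : ∀ k → 0ℚ choose suc k ≡ 0ℚ
0-choose-suc zero    = refl
0-choose-suc (suc k) = trans (cong (_* ((0ℚ - ℕ→ℚ (suc k)) * 1/suc (suc k))) (0-choose-suc k)) (*-zeroˡ ((0ℚ - ℕ→ℚ (suc k)) * 1/suc (suc k)))

1/suc-step : ∀ k → 1/suc (suc k) * (1/suc k + 1ℚ) ≡ 1/suc k
1/suc-step k = begin
  c' * (c + 1ℚ)                  ≡⟨ cong (λ z → c' * (c + z)) (sym (1/suc-inverse k)) ⟩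
  c' * (c + c * a')              ≡⟨ solve 3 (λ c c' a' → c' :* (c :+ c :* a') := c :* (c' :* (a' :+ 𝟙))) refl c c' a' ⟩
  c * (c' * (a' + 1ℚ))           ≡⟨ cong (λ z → c * (c' * z)) (sym (ℕ→ℚ-suc (suc k))) ⟩
  c * (c' * ℕ→ℚ (suc (suc k)))   ≡⟨ cong (c *_) (1/suc-inverse (suc k)) ⟩
  c * 1ℚ                         ≡⟨ *-identityʳ c ⟩
  c                              ∎
  where
  a' c c' : ℚ
  a' = ℕ→ℚ (suc k)
  c  = 1/suc k
  c' = 1/suc (suc k)

choose-pascal : ∀ x k → (x + 1ℚ) choose suc k ≡ x choose suc k + x choose k
choose-pascal x zero    = solve 1 (λ x → 𝟙 :* ((x :+ 𝟙 :- 𝟘) :* 𝟙)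
                                      := 𝟙 :* ((x :- 𝟘) :* 𝟙) :+ 𝟙) refl x
choose-pascal x (suc k) = begin
  (x + 1ℚ) choose suc k * ((x + 1ℚ - a') * c')
    ≡⟨ cong₂ (λ u w → u * ((x + 1ℚ - w) * c')) (choose-pascal x k) (ℕ→ℚ-suc k) ⟩
  (B1 + B0) * ((x + 1ℚ - (a + 1ℚ)) * c')
    ≡⟨ solve 5 (λ B0 x a c c' →
         (B0 :* ((x :- a) :* c) :+ B0) :* ((x :+ 𝟙 :- (a :+ 𝟙)) :* c')
         := B0 :* ((x :- a) :* c) :* ((x :- (a :+ 𝟙)) :* c') :+ B0 :* ((x :- a) :* c)
            :+ B0 :* (x :- a) :* (c' :* (c :+ 𝟙) :- c)) refl B0 x a c c' ⟩
  B1 * ((x - (a + 1ℚ)) * c') + B1 + B0 * (x - a) * (c' * (c + 1ℚ) - c)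
    ≡⟨ cong (λ z → B1 * ((x - (a + 1ℚ)) * c') + B1 + B0 * (x - a) * (z - c)) (1/suc-step k) ⟩
  B1 * ((x - (a + 1ℚ)) * c') + B1 + B0 * (x - a) * (c - c)
    ≡⟨ cong (λ z → B1 * ((x - (a + 1ℚ)) * c') + B1 + B0 * (x - a) * z) (+-inverseʳ c) ⟩
  B1 * ((x - (a + 1ℚ)) * c') + B1 + B0 * (x - a) * 0ℚ
    ≡⟨ trans (cong (B1 * ((x - (a + 1ℚ)) * c') + B1 +_) (*-zeroʳ (B0 * (x - a)))) (+-identityʳ (B1 * ((x - (a + 1ℚ)) * c') + B1)) ⟩
  B1 * ((x - (a + 1ℚ)) * c') + B1
    ≡⟨ cong (λ w → B1 * ((x - w) * c') + B1) (sym (ℕ→ℚ-suc k)) ⟩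
  B1 * ((x - a') * c') + B1
    ∎
  where
  a a' c c' B0 B1 : ℚ
  a  = ℕ→ℚ k
  a' = ℕ→ℚ (suc k)
  c  = 1/suc k
  c' = 1/suc (suc k)
  B0 = x choose k
  B1 = x choose suc k

∑< : ℕ → (ℕ → ℚ) → ℚ
∑< zero    f = 0ℚ
∑< (suc N) f = ∑< N f + f N

syntax ∑< N (λ k → e) = ∑[ k < N ] e

∑<-distrib-- : ∀ N (a f g : ℕ → ℚ) → ∑[ k < N ] (a k * (f k - g k)) ≡ ∑[ k < N ] (a k * f k) - ∑[ k < N ] (a k * g k)
∑<-distrib-- zero    a f g = refl
∑<-distrib-- (suc N) a f g = trans (cong (_+ a N * (f N - g N)) (∑<-distrib-- N a f g))
  (solve 5 (λ A B x y z → (A :- B) :+ x :* (y :- z) := (A :+ x :* y) :- (B :+ x :* z)) refl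
    (∑[ k < N ] (a k * f k)) (∑[ k < N ] (a k * g k)) (a N) (f N) (g N))

isPolynomial-∑< : ∀ N (h : ℕ → ℚ → ℚ) → (∀ k → IsPolynomial (h k)) → IsPolynomial (λ x → ∑[ k < N ] h k x)
isPolynomial-∑< zero    h p = isPolynomial-const 0ℚ
isPolynomial-∑< (suc N) h p = isPolynomial-+ (isPolynomial-∑< N h p) (p N)

∑<-pascal : ∀ N (c : ℕ → ℚ) x →
  ∑[ k < suc N ] ((x + 1ℚ) choose k * c k) ≡ ∑[ k < suc N ] (x choose k * c k) + ∑[ k < N ] (x choose k * c (suc k))
∑<-pascal zero    c x = sym (+-identityʳ (0ℚ + 1ℚ * c 0))
∑<-pascal (suc N) c x = begin
  ∑[ k < suc N ] ((x + 1ℚ) choose k * c k) + (x + 1ℚ) choose suc N * c (suc N)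
    ≡⟨ cong₂ (λ u v → u + v * c (suc N)) (∑<-pascal N c x) (choose-pascal x N) ⟩
  (S + S') + (x choose suc N + x choose N) * c (suc N)
    ≡⟨ solve 5 (λ A B b₁ b₀ c → (A :+ B) :+ (b₁ :+ b₀) :* c := (A :+ b₁ :* c) :+ (B :+ b₀ :* c))
         refl S S' (x choose suc N) (x choose N) (c (suc N)) ⟩
  (S + x choose suc N * c (suc N)) + (S' + x choose N * c (suc N)) ∎
  where
  S S' : ℚ
  S  = ∑[ k < suc N ] (x choose k * c k)
  S' = ∑[ k < N ] (x choose k * c (suc k))

∑<-0-choose : ∀ N (c : ℕ → ℚ) → ∑[ k < suc N ] (0ℚ choose k * c k) ≡ c 0
∑<-0-choose zero    c = trans (+-identityˡ (1ℚ * c 0)) (*-identityˡ (c 0))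
∑<-0-choose (suc N) c = trans (cong₂ _+_ (∑<-0-choose N c) (trans (cong (_* c (suc N)) (0-choose-suc N)) (*-zeroˡ (c (suc N)))))
                              (+-identityʳ (c 0))

-- Subsets

bitsBelow : Bool → List Bool
bitsBelow false = false ∷ []
bitsBelow true  = false ∷ true ∷ []

∑⊆ : ∀ {n} → Subset n → (Subset n → ℚ) → ℚ
∑⊆ U = ∑ᵛ (V.map bitsBelow U)

syntax ∑⊆ U (λ M → e) = ∑[ M ⊆ U ] e

infix 4 _⊆_

_⊆_ : ∀ {n} → Subset n → Subset n → Set
M ⊆ U = M ∈ᵛ V.map bitsBelow U

∅ : ∀ {n} → Subset n
∅ = replicate _ false

_∖ᵇ_ : Bool → Bool → Bool
u ∖ᵇ true  = false
u ∖ᵇ false = u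

infixl 6 _∖_

_∖_ : ∀ {n} → Subset n → Subset n → Subset n
_∖_ = V.zipWith _∖ᵇ_

isEmpty : ∀ {n} → Subset n → Bool
isEmpty []           = true
isEmpty (true  ∷ M)  = false
isEmpty (false ∷ M)  = isEmpty M

δ∅ : ∀ {n} → Subset n → ℚ
δ∅ M = if isEmpty M then 1ℚ else 0ℚ

size : ∀ {n} → Subset n → ℕ
size []          = 0
size (true  ∷ M) = suc (size M)
size (false ∷ M) = size M

signᵇ : Bool → ℚ
signᵇ true  = - 1ℚ
signᵇ false = 1ℚ

sign : ∀ {n} → Subset n → ℚ
sign []      = 1ℚ
sign (b ∷ M) = signᵇ b * sign M

∈bitsBelow-false : ∀ {b} → b ∈ bitsBelow false → b ≡ false
∈bitsBelow-false (here b≡false) = b≡false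

isEmpty⇒≡∅ : ∀ {n} (M : Subset n) → isEmpty M ≡ true → M ≡ ∅
isEmpty⇒≡∅ []          _     = refl
isEmpty⇒≡∅ (false ∷ M) empty = cong (false ∷_) (isEmpty⇒≡∅ M empty)

∖-∅ : ∀ {n} (U : Subset n) → U ∖ ∅ ≡ U
∖-∅ []      = refl
∖-∅ (u ∷ U) = cong (u ∷_) (∖-∅ U)

∑⊆-δ∅ : ∀ {n} (U : Subset n) c → ∑[ M ⊆ U ] (δ∅ M * c) ≡ c
∑⊆-δ∅ []          c = *-identityˡ c
∑⊆-δ∅ (false ∷ U) c = trans (+-identityʳ _) (∑⊆-δ∅ U c)
∑⊆-δ∅ (true  ∷ U) c = begin
  ∑[ M ⊆ U ] (δ∅ M * c) + (∑[ M ⊆ U ] (0ℚ * c) + 0ℚ)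
    ≡⟨ cong₂ (λ a b → a + (b + 0ℚ)) (∑⊆-δ∅ U c) (trans (∑ᵛ-cong (V.map bitsBelow U) (λ _ → *-zeroˡ c)) (∑ᵛ-zero (V.map bitsBelow U))) ⟩
  c + (0ℚ + 0ℚ)  ≡⟨ +-identityʳ c ⟩
  c              ∎

∑⊆-∅ : ∀ n (F : Subset n → ℚ) → ∑[ M ⊆ ∅ {n} ] F M ≡ F ∅
∑⊆-∅ zero    F = refl
∑⊆-∅ (suc n) F = trans (+-identityʳ _) (∑⊆-∅ n (λ M → F (false ∷ M)))

size-∖ : ∀ {n} (U M : Subset n) → M ⊆ U → size (U ∖ M) ≤ size U
size-∖ []          []          []            = z≤n
size-∖ (false ∷ U) (b ∷ M)     (b∈ ∷ M⊆U) rewrite ∈bitsBelow-false b∈ = size-∖ U M M⊆U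
size-∖ (true ∷ U)  (false ∷ M) (_ ∷ M⊆U)  = s≤s (size-∖ U M M⊆U)
size-∖ (true ∷ U)  (true ∷ M)  (_ ∷ M⊆U)  = ℕP.m≤n⇒m≤1+n (size-∖ U M M⊆U)

size-∖-nonempty : ∀ {n} (U M : Subset n) → M ⊆ U → isEmpty M ≡ false → size (U ∖ M) < size U
size-∖-nonempty (false ∷ U) (b ∷ M)     (b∈ ∷ M⊆U) ne rewrite ∈bitsBelow-false b∈ = size-∖-nonempty U M M⊆U ne
size-∖-nonempty (true ∷ U)  (false ∷ M) (_ ∷ M⊆U)  ne = s≤s (size-∖-nonempty U M M⊆U ne)
size-∖-nonempty (true ∷ U)  (true ∷ M)  (_ ∷ M⊆U)  _  = s≤s (size-∖ U M M⊆U)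

size≤n : ∀ {n} (U : Subset n) → size U ≤ n
size≤n []          = z≤n
size≤n (true  ∷ U) = s≤s (size≤n U)
size≤n (false ∷ U) = ℕP.m≤n⇒m≤1+n (size≤n U)

∑⊆-unitriangular : ∀ {n} (t : Subset n → Subset n → ℚ) (U : Subset n) (G : Subset n → ℚ) → t U ∅ ≡ 1ℚ →
                   (∀ M → M ⊆ U → isEmpty M ≡ false → G (U ∖ M) ≡ 0ℚ) →
                   ∑[ M ⊆ U ] (t U M * G (U ∖ M)) ≡ G U
∑⊆-unitriangular {n} t U G tU∅≡1 G≡0 = trans (∑ᵛ-cong∈ (V.map bitsBelow U) term) (∑⊆-δ∅ U (G U))
  where
  term : ∀ M → M ⊆ U → t U M * G (U ∖ M) ≡ δ∅ M * G U
  term M M⊆U with isEmpty M in eq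
  ... | true  = begin
    t U M * G (U ∖ M)    ≡⟨ cong (λ M' → t U M' * G (U ∖ M')) (isEmpty⇒≡∅ M eq) ⟩
    t U ∅ * G (U ∖ ∅)    ≡⟨ cong₂ (λ a b → a * G b) tU∅≡1 (∖-∅ U) ⟩
    1ℚ * G U             ∎
  ... | false = trans (cong (t U M *_) (G≡0 M M⊆U eq)) (trans (*-zeroʳ (t U M)) (sym (*-zeroˡ (G U))))

δ∅-absorbs-∖ : ∀ {n} (U T : Subset n) (G : Subset n → ℚ) → δ∅ T * G (U ∖ T) ≡ δ∅ T * G U
δ∅-absorbs-∖ U T G with isEmpty T in eq
... | true  = trans (cong (λ T' → 1ℚ * G (U ∖ T')) (isEmpty⇒≡∅ T eq)) (cong (λ V → 1ℚ * G V) (∖-∅ U))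
... | false = trans (*-zeroˡ (G (U ∖ T))) (sym (*-zeroˡ (G U)))

sign² : ∀ {n} (M : Subset n) → sign M * sign M ≡ 1ℚ
sign² []          = refl
sign² (true  ∷ M) = trans (solve 1 (λ s → (:- 𝟙 :* s) :* (:- 𝟙 :* s) := s :* s) refl (sign M)) (sign² M)
sign² (false ∷ M) = trans (solve 1 (λ s → (𝟙 :* s) :* (𝟙 :* s) := s :* s) refl (sign M)) (sign² M)

sign-∅ : ∀ n → sign (∅ {n}) ≡ 1ℚ
sign-∅ zero    = refl
sign-∅ (suc n) = trans (*-identityˡ (sign (∅ {n}))) (sign-∅ n)

sign-full : ∀ n → sign (replicate n true) ≡ pow (- 1ℚ) n
sign-full zero    = refl
sign-full (suc n) = cong (- 1ℚ *_) (sign-full n)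

sign-∖ : ∀ {n} (U M : Subset n) → M ⊆ U → sign U ≡ sign M * sign (U ∖ M)
sign-∖ []          []          []           = refl
sign-∖ (false ∷ U) (b ∷ M)     (b∈ ∷ M⊆U) rewrite ∈bitsBelow-false b∈ =
  trans (cong (1ℚ *_) (sign-∖ U M M⊆U))
        (solve 2 (λ a c → 𝟙 :* (a :* c) := 𝟙 :* a :* (𝟙 :* c)) refl (sign M) (sign (U ∖ M)))
sign-∖ (true ∷ U)  (false ∷ M) (_ ∷ M⊆U) =
  trans (cong (- 1ℚ *_) (sign-∖ U M M⊆U))
        (solve 2 (λ a c → :- 𝟙 :* (a :* c) := 𝟙 :* a :* (:- 𝟙 :* c)) refl (sign M) (sign (U ∖ M)))
sign-∖ (true ∷ U)  (true ∷ M)  (_ ∷ M⊆U) =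
  trans (cong (- 1ℚ *_) (sign-∖ U M M⊆U))
        (solve 2 (λ a c → :- 𝟙 :* (a :* c) := :- 𝟙 :* a :* (𝟙 :* c)) refl (sign M) (sign (U ∖ M)))

sign*δ∅ : ∀ {n} (U : Subset n) → sign U * δ∅ U ≡ δ∅ U
sign*δ∅ []          = *-identityˡ 1ℚ
sign*δ∅ (true  ∷ U) = *-zeroʳ (sign (true ∷ U))
sign*δ∅ (false ∷ U) = trans (*-assoc 1ℚ (sign U) (δ∅ U)) (trans (*-identityˡ (sign U * δ∅ U)) (sign*δ∅ U))

sign-flip : ∀ {n} (v : Fin n) (M : Subset n) → sign (updateAt M v not) ≡ - sign M
sign-flip zero    (true  ∷ M) = solve 1 (λ s → 𝟙 :* s := :- (:- 𝟙 :* s)) refl (sign M)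
sign-flip zero    (false ∷ M) = solve 1 (λ s → :- 𝟙 :* s := :- (𝟙 :* s)) refl (sign M)
sign-flip (suc v) (b ∷ M)     = trans (cong (signᵇ b *_) (sign-flip v M)) (sym (neg-distribʳ-* (signᵇ b) (sign M)))

∖-∖ : ∀ {n} (U T M : Subset n) → T ⊆ U → M ⊆ T → (U ∖ M) ∖ (T ∖ M) ≡ U ∖ T
∖-∖ []      []      []      []         []         = refl
∖-∖ (u ∷ U) (t ∷ T) (b ∷ M) (t∈ ∷ T⊆U) (b∈ ∷ M⊆T) = cong₂ _∷_ (bit u t b b∈) (∖-∖ U T M T⊆U M⊆T)
  where
  bit : ∀ u t b → b ∈ bitsBelow t → (u ∖ᵇ b) ∖ᵇ (t ∖ᵇ b) ≡ u ∖ᵇ t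
  bit u true  true  _           = refl
  bit u true  false _           = refl
  bit u false false _           = refl
  bit u false true  (here ())
  bit u false true  (there ())

-- The bijection (M₁, M₂) ↦ (M₁ ∪ M₂, M₁).
∑⊆-∑⊆-regroup : ∀ {n} (U : Subset n) (G : Subset n → Subset n → ℚ) →
                ∑[ M₁ ⊆ U ] ∑[ M₂ ⊆ U ∖ M₁ ] G M₁ M₂ ≡ ∑[ T ⊆ U ] ∑[ M₁ ⊆ T ] G M₁ (T ∖ M₁)
∑⊆-∑⊆-regroup []      G = refl
∑⊆-∑⊆-regroup (u ∷ U) G = begin
  ∑ (bitsBelow u) (λ b₁ → ∑[ M₁ ⊆ U ] ∑ (bitsBelow (u ∖ᵇ b₁)) (λ b₂ → ∑[ M₂ ⊆ U ∖ M₁ ] G (b₁ ∷ M₁) (b₂ ∷ M₂)))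
    ≡⟨ ∑-cong (bitsBelow u) (λ b₁ → sym (∑-∑ᵛ-comm (bitsBelow (u ∖ᵇ b₁)) (V.map bitsBelow U)
         (λ b₂ M₁ → ∑[ M₂ ⊆ U ∖ M₁ ] G (b₁ ∷ M₁) (b₂ ∷ M₂)))) ⟩
  ∑ (bitsBelow u) (λ b₁ → ∑ (bitsBelow (u ∖ᵇ b₁)) (λ b₂ → ∑[ M₁ ⊆ U ] ∑[ M₂ ⊆ U ∖ M₁ ] G (b₁ ∷ M₁) (b₂ ∷ M₂)))
    ≡⟨ ∑-cong (bitsBelow u) (λ b₁ → ∑-cong (bitsBelow (u ∖ᵇ b₁)) (λ b₂ → ∑⊆-∑⊆-regroup U (λ M₁ M₂ → G (b₁ ∷ M₁) (b₂ ∷ M₂)))) ⟩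
  ∑ (bitsBelow u) (λ b₁ → ∑ (bitsBelow (u ∖ᵇ b₁)) (H b₁))
    ≡⟨ regroup-bit u H ⟩
  ∑ (bitsBelow u) (λ t → ∑ (bitsBelow t) (λ b → H b (t ∖ᵇ b)))
    ≡⟨ ∑-cong (bitsBelow u) (λ t → ∑-∑ᵛ-comm (bitsBelow t) (V.map bitsBelow U)
         (λ b T → ∑[ M₁ ⊆ T ] G (b ∷ M₁) (t ∖ᵇ b ∷ T ∖ M₁))) ⟩
  ∑ (bitsBelow u) (λ t → ∑[ T ⊆ U ] ∑ (bitsBelow t) (λ b → ∑[ M₁ ⊆ T ] G (b ∷ M₁) (t ∖ᵇ b ∷ T ∖ M₁)))
    ∎
  where
  H : Bool → Bool → ℚ
  H b₁ b₂ = ∑[ T ⊆ U ] ∑[ M₁ ⊆ T ] G (b₁ ∷ M₁) (b₂ ∷ T ∖ M₁)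
  regroup-bit : ∀ u (h : Bool → Bool → ℚ) →
    ∑ (bitsBelow u) (λ b₁ → ∑ (bitsBelow (u ∖ᵇ b₁)) (h b₁)) ≡ ∑ (bitsBelow u) (λ t → ∑ (bitsBelow t) (λ b → h b (t ∖ᵇ b)))
  regroup-bit false h = refl
  regroup-bit true  h = solve 3 (λ a b c → (a :+ (b :+ 𝟘)) :+ ((c :+ 𝟘) :+ 𝟘)
                                        := (a :+ 𝟘) :+ ((b :+ (c :+ 𝟘)) :+ 𝟘))
                                refl (h false false) (h false true) (h true false)

nonempty : ∀ {n} (T : Subset n) → isEmpty T ≡ false → Σ (Fin n) λ v → lookup T v ≡ true
nonempty (true  ∷ T) _  = zero , refl
nonempty (false ∷ T) ne = suc (proj₁ (nonempty T ne)) , proj₂ (nonempty T ne)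

-- Weighted colourings and peeling off a colour class

tailOf headOf : ∀ {n m} → Digraph n m → Fin m → Fin n
tailOf D i = proj₁ (D i)
headOf D i = proj₂ (D i)

orient : (up flat down : ℚ) → ℕ → ℕ → ℚ
orient up flat down i j = if i <ᵇ j then up else if j <ᵇ i then down else flat

<ᵇ-true : ∀ {i j} → i < j → (i <ᵇ j) ≡ true
<ᵇ-true {zero}  (s≤s _)   = refl
<ᵇ-true {suc i} (s≤s i<j) = <ᵇ-true i<j

<ᵇ-false : ∀ {i j} → j < i → (i <ᵇ j) ≡ false
<ᵇ-false {suc i} {zero}  _         = refl
<ᵇ-false {suc i} {suc j} (s≤s j<i) = <ᵇ-false j<i

<ᵇ-asym : ∀ i j → (i ℕ.<ᵇ j) ≡ true → (j ℕ.<ᵇ i) ≡ false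
<ᵇ-asym zero    (suc j) _   = refl
<ᵇ-asym (suc i) (suc j) i<j = <ᵇ-asym i j i<j

module _ {up flat down : ℚ} where

  orient-refl : ∀ i → orient up flat down i i ≡ flat
  orient-refl zero    = refl
  orient-refl (suc i) = orient-refl i

  orient-< : ∀ {i j} → i < j → orient up flat down i j ≡ up
  orient-< i<j rewrite <ᵇ-true i<j = refl

  orient-> : ∀ {i j} → j < i → orient up flat down i j ≡ down
  orient-> j<i rewrite <ᵇ-false j<i | <ᵇ-true j<i = refl

-- The factor of an arc, from whether its tail and head lie in M and in U.
ArcRule : Set
ArcRule = Bool → Bool → Bool → Bool → ℚ

arcFactor : ∀ {n m} → Digraph n m → ArcRule → Subset n → Subset n → Fin m → ℚ
arcFactor D arc U M i = arc (lookup M (tailOf D i)) (lookup M (headOf D i)) (lookup U (tailOf D i)) (lookup U (headOf D i))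

peelingFactor : ∀ {n m} → Digraph n m → ArcRule → Subset n → Subset n → ℚ
peelingFactor D arc U M = ∏ (arcFactor D arc U M)

peelingFactor-∅ : ∀ {n m} (D : Digraph n m) arc → (∀ ut uh → arc false false ut uh ≡ 1ℚ) → ∀ U → peelingFactor D arc U ∅ ≡ 1ℚ
peelingFactor-∅ D arc arc≡1 U = ∏-one _ (λ i → trans
  (cong₂ (λ a b → arc a b (lookup U (tailOf D i)) (lookup U (headOf D i))) (lookup-replicate (tailOf D i) false) (lookup-replicate (headOf D i) false))
  (arc≡1 _ _))

topArc bottomArc : (up flat down : ℚ) → ArcRule
topArc    up flat down true  true  _  _  = flat
topArc    up flat down true  false _  uh = if uh then down else 1ℚ
topArc    up flat down false true  ut _  = if ut then up else 1ℚ
topArc    up flat down false false _  _  = 1ℚ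
bottomArc up flat down true  true  _  _  = flat
bottomArc up flat down true  false _  uh = if uh then up else 1ℚ
bottomArc up flat down false true  ut _  = if ut then down else 1ℚ
bottomArc up flat down false false _  _  = 1ℚ

data Peeled {q : ℕ} : Bool → Bool → Maybe (Fin q) → Set where
  peeled : Peeled true true nothing
  kept   : ∀ a → Peeled false true (just a)
  absent : Peeled false false nothing

module WeightedColourings {n m : ℕ} (D : Digraph n m) (up flat down : ℚ) where

  weight : ∀ {q} → Fin q → Fin q → ℚ
  weight a b = orient up flat down (toℕ a) (toℕ b)

  weightᵐ : ∀ {q} → Maybe (Fin q) → Maybe (Fin q) → ℚ
  weightᵐ (just a) (just b) = weight a b
  weightᵐ (just a) nothing  = 1ℚ
  weightᵐ nothing  _        = 1ℚ

  colouringWeight : ∀ {q} → Vec (Maybe (Fin q)) n → ℚ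
  colouringWeight c = ∏ (λ i → weightᵐ (lookup c (tailOf D i)) (lookup c (headOf D i)))

  colours : (q : ℕ) → Bool → List (Maybe (Fin q))
  colours q true  = L.map just (L.allFin q)
  colours q false = nothing ∷ []

  -- A colouring of U is a vector that is nothing exactly off U, so Z U q is the
  -- total weight of the q-colourings of the subdigraph induced by U.
  Z : Subset n → ℕ → ℚ
  Z U q = ∑ᵛ (V.map (colours q) U) colouringWeight

  Z-zero : ∀ U → Z U 0 ≡ δ∅ U
  Z-zero U = trans (no-colours U colouringWeight)
                   (trans (cong (δ∅ U *_) (∏-one _ (λ i → cong₂ weightᵐ (lookup-replicate (tailOf D i) nothing)
                                                                          (lookup-replicate (headOf D i) nothing))))
                          (*-identityʳ (δ∅ U)))
    where
    no-colours : ∀ {k} (U : Subset k) F → ∑ᵛ (V.map (colours 0) U) F ≡ δ∅ U * F (replicate k nothing)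
    no-colours []          F = sym (*-identityˡ (F []))
    no-colours (true  ∷ U) F = sym (*-zeroˡ (F (replicate _ nothing)))
    no-colours (false ∷ U) F = trans (+-identityʳ _) (no-colours U (λ v → F (nothing ∷ v)))

  peeled-view : ∀ {q b u} {c : Maybe (Fin q)} → b ∈ bitsBelow u → c ∈ colours q (u ∖ᵇ b) → Peeled b u c
  peeled-view {b = true}  {true}  _          (here refl) = peeled
  peeled-view {b = false} {true}  _          c∈          with ∈-map⁻ just c∈
  ... | a , _ , refl = kept a
  peeled-view {b = false} {false} _          (here refl) = absent
  peeled-view {b = true}  {false} (here ())  _
  peeled-view {b = true}  {false} (there ()) _

  -- Colourings with q + 1 colours, split by the class M of an extreme colour.
  module Peel (q : ℕ) (embed : Bool → Maybe (Fin q) → Maybe (Fin (suc q)))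
              (arc : ArcRule)
              (embed-absent : embed false nothing ≡ nothing)
              (split : ∀ f → ∑ (colours (suc q) true) f ≡ ∑ (colours q true) (f ∘ embed false) + f (embed true nothing))
              (arc-factor : ∀ {bt bh ut uh} {ct ch : Maybe (Fin q)} → Peeled bt ut ct → Peeled bh uh ch →
                            weightᵐ (embed bt ct) (embed bh ch) ≡ arc bt bh ut uh * weightᵐ ct ch) where

    fibres : ∀ u (f : Maybe (Fin (suc q)) → ℚ) →
             ∑ (colours (suc q) u) f ≡ ∑ (bitsBelow u) (λ b → ∑ (colours q (u ∖ᵇ b)) (f ∘ embed b))
    fibres true  f = trans (split f) (cong (∑ (colours q true) (f ∘ embed false) +_)
                                           (sym (trans (+-identityʳ (f (embed true nothing) + 0ℚ)) (+-identityʳ (f (embed true nothing))))))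
    fibres false f = trans (cong (λ c → f c + 0ℚ) (sym embed-absent)) (sym (+-identityʳ (f (embed false nothing) + 0ℚ)))

    peel : ∀ U → Z U (suc q) ≡ ∑[ M ⊆ U ] (peelingFactor D arc U M * Z (U ∖ M) q)
    peel U = begin
      ∑ᵛ (V.map (colours (suc q)) U) colouringWeight
        ≡⟨ ∑ᵛ-fibres (colours (suc q)) bitsBelow (λ u b → colours q (u ∖ᵇ b)) embed fibres U colouringWeight ⟩
      ∑[ M ⊆ U ] ∑ᵛ (V.zipWith (λ u b → colours q (u ∖ᵇ b)) U M) (λ c → colouringWeight (V.zipWith embed M c))
        ≡⟨ ∑ᵛ-cong∈ (V.map bitsBelow U) (λ M M⊆U → trans
             (cong (λ Ls → ∑ᵛ Ls (λ c → colouringWeight (V.zipWith embed M c))) (sym (zipWith-map-colours U M)))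
             (factorise M M⊆U)) ⟩
      ∑[ M ⊆ U ] (peelingFactor D arc U M * Z (U ∖ M) q) ∎
      where
      zipWith-map-colours : ∀ {k} (U M : Subset k) → V.map (colours q) (U ∖ M) ≡ V.zipWith (λ u b → colours q (u ∖ᵇ b)) U M
      zipWith-map-colours []      []      = refl
      zipWith-map-colours (u ∷ U) (b ∷ M) = cong (colours q (u ∖ᵇ b) ∷_) (zipWith-map-colours U M)

      factorise : ∀ M → M ⊆ U → ∑ᵛ (V.map (colours q) (U ∖ M)) (λ c → colouringWeight (V.zipWith embed M c))
                                ≡ peelingFactor D arc U M * Z (U ∖ M) q
      factorise M M⊆U = trans (∑ᵛ-cong∈ (V.map (colours q) (U ∖ M)) per-colouring)
                              (sym (∑ᵛ-distribˡ (V.map (colours q) (U ∖ M)) (peelingFactor D arc U M) colouringWeight))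
        where
        per-colouring : ∀ c → c ∈ᵛ V.map (colours q) (U ∖ M) →
                        colouringWeight (V.zipWith embed M c) ≡ peelingFactor D arc U M * colouringWeight c
        per-colouring c c∈ = trans (∏-cong per-arc) (∏-distrib-* (arcFactor D arc U M) (λ i → weightᵐ (lookup c (tailOf D i)) (lookup c (headOf D i))))
          where
          view : ∀ v → Peeled (lookup M v) (lookup U v) (lookup c v)
          view v = peeled-view
            (subst (lookup M v ∈_) (lookup-map v bitsBelow U) (Pointwise.lookup M⊆U v))
            (subst (lookup c v ∈_) (trans (lookup-map v (colours q) (U ∖ M)) (cong (colours q) (lookup-zipWith _∖ᵇ_ v U M)))
                   (Pointwise.lookup c∈ v))
          per-arc : ∀ i → weightᵐ (lookup (V.zipWith embed M c) (tailOf D i)) (lookup (V.zipWith embed M c) (headOf D i))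
                          ≡ arcFactor D arc U M i * weightᵐ (lookup c (tailOf D i)) (lookup c (headOf D i))
          per-arc i = trans (cong₂ weightᵐ (lookup-zipWith embed (tailOf D i) M c) (lookup-zipWith embed (headOf D i) M c))
                            (arc-factor (view (tailOf D i)) (view (headOf D i)))

  topFactor bottomFactor : Subset n → Subset n → ℚ
  topFactor    = peelingFactor D (topArc up flat down)
  bottomFactor = peelingFactor D (bottomArc up flat down)

  private
    embedTop embedBottom : ∀ {q} → Bool → Maybe (Fin q) → Maybe (Fin (suc q))
    embedTop {q} true  _ = just (fromℕ q)
    embedTop     false c = Maybe.map inject₁ c
    embedBottom  true  _ = just zero
    embedBottom  false c = Maybe.map suc c

    inject₁<fromℕ : ∀ {q} (a : Fin q) → toℕ (inject₁ a) < toℕ (fromℕ q)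
    inject₁<fromℕ {q} a rewrite FinP.toℕ-inject₁ a | FinP.toℕ-fromℕ q = FinP.toℕ<n a

    1≡1*1 : 1ℚ ≡ 1ℚ * 1ℚ
    1≡1*1 = sym (*-identityˡ 1ℚ)

    topArc-factor : ∀ {q bt bh ut uh} {ct ch : Maybe (Fin q)} → Peeled bt ut ct → Peeled bh uh ch →
                    weightᵐ (embedTop bt ct) (embedTop bh ch) ≡ topArc up flat down bt bh ut uh * weightᵐ ct ch
    topArc-factor {q} peeled   peeled   = trans (orient-refl (toℕ (fromℕ q))) (sym (*-identityʳ flat))
    topArc-factor     peeled   (kept b) = trans (orient-> (inject₁<fromℕ b)) (sym (*-identityʳ down))
    topArc-factor     peeled   absent   = 1≡1*1
    topArc-factor     (kept a) peeled   = trans (orient-< (inject₁<fromℕ a)) (sym (*-identityʳ up))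
    topArc-factor     (kept a) (kept b) = trans (cong₂ (orient up flat down) (FinP.toℕ-inject₁ a) (FinP.toℕ-inject₁ b)) (sym (*-identityˡ (weight a b)))
    topArc-factor     (kept a) absent   = 1≡1*1
    topArc-factor     absent   peeled   = 1≡1*1
    topArc-factor     absent   (kept b) = 1≡1*1
    topArc-factor     absent   absent   = 1≡1*1

    bottomArc-factor : ∀ {q bt bh ut uh} {ct ch : Maybe (Fin q)} → Peeled bt ut ct → Peeled bh uh ch →
                       weightᵐ (embedBottom bt ct) (embedBottom bh ch) ≡ bottomArc up flat down bt bh ut uh * weightᵐ ct ch
    bottomArc-factor peeled   peeled   = sym (*-identityʳ flat)
    bottomArc-factor peeled   (kept b) = sym (*-identityʳ up)
    bottomArc-factor peeled   absent   = 1≡1*1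
    bottomArc-factor (kept a) peeled   = sym (*-identityʳ down)
    bottomArc-factor (kept a) (kept b) = sym (*-identityˡ (weight a b))
    bottomArc-factor (kept a) absent   = 1≡1*1
    bottomArc-factor absent   peeled   = 1≡1*1
    bottomArc-factor absent   (kept b) = 1≡1*1
    bottomArc-factor absent   absent   = 1≡1*1

    ∑-colours-map : ∀ {q q'} (h : Fin q → Fin q') (f : Maybe (Fin q') → ℚ) →
                    ∑ (colours q true) (f ∘ Maybe.map h) ≡ ∑ (L.allFin q) (λ a → f (just (h a)))
    ∑-colours-map {q} h f = ∑-map just (L.allFin q) (f ∘ Maybe.map h)

    splitTop : ∀ q f → ∑ (colours (suc q) true) f ≡ ∑ (colours q true) (f ∘ embedTop false) + f (embedTop true nothing)
    splitTop q f = begin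
      ∑ (colours (suc q) true) f                                     ≡⟨ ∑-map just (L.allFin (suc q)) f ⟩
      ∑ (L.allFin (suc q)) (f ∘ just)                               ≡⟨ ∑-allFin-last q (f ∘ just) ⟩
      ∑ (L.allFin q) (λ a → f (just (inject₁ a))) + f (just (fromℕ q)) ≡⟨ cong (_+ f (just (fromℕ q))) (sym (∑-colours-map inject₁ f)) ⟩
      ∑ (colours q true) (f ∘ embedTop false) + f (embedTop true nothing) ∎

    splitBottom : ∀ q f → ∑ (colours (suc q) true) f ≡ ∑ (colours q true) (f ∘ embedBottom false) + f (embedBottom true nothing)
    splitBottom q f = begin
      ∑ (colours (suc q) true) f                               ≡⟨ ∑-map just (L.allFin (suc q)) f ⟩
      ∑ (L.allFin (suc q)) (f ∘ just)                         ≡⟨ ∑-allFin-first q (f ∘ just) ⟩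
      ∑ (L.allFin q) (λ a → f (just (suc a))) + f (just zero)  ≡⟨ cong (_+ f (just zero)) (sym (∑-colours-map suc f)) ⟩
      ∑ (colours q true) (f ∘ embedBottom false) + f (embedBottom true nothing) ∎

  Z-suc-top : ∀ U q → Z U (suc q) ≡ ∑[ M ⊆ U ] (topFactor U M * Z (U ∖ M) q)
  Z-suc-top U q = Peel.peel q embedTop (topArc up flat down) refl (splitTop q) topArc-factor U

  Z-suc-bottom : ∀ U q → Z U (suc q) ≡ ∑[ M ⊆ U ] (bottomFactor U M * Z (U ∖ M) q)
  Z-suc-bottom U q = Peel.peel q embedBottom (bottomArc up flat down) refl (splitBottom q) bottomArc-factor U

-- Newton interpolation and reciprocity

module Interpolation {n m : ℕ} (D : Digraph n m) (up flat down : ℚ) where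
  open WeightedColourings D up flat down

  topTransfer : (Subset n → ℚ) → Subset n → ℚ
  topTransfer X U = ∑[ M ⊆ U ] (topFactor U M * X (U ∖ M))

  topTransfer-cong : ∀ {X Y} → (∀ V → X V ≡ Y V) → ∀ U → topTransfer X U ≡ topTransfer Y U
  topTransfer-cong X≗Y U = ∑ᵛ-cong (V.map bitsBelow U) (λ M → cong (topFactor U M *_) (X≗Y (U ∖ M)))

  topTransfer-∑< : ∀ N (a : ℕ → ℚ) (X : ℕ → Subset n → ℚ) U →
                   topTransfer (λ V → ∑[ k < N ] (a k * X k V)) U ≡ ∑[ k < N ] (a k * topTransfer (X k) U)
  topTransfer-∑< zero    a X U = trans (∑ᵛ-cong (V.map bitsBelow U) (λ M → *-zeroʳ (topFactor U M))) (∑ᵛ-zero (V.map bitsBelow U))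
  topTransfer-∑< (suc N) a X U = begin
    ∑[ M ⊆ U ] (topFactor U M * (∑[ k < N ] (a k * X k (U ∖ M)) + a N * X N (U ∖ M)))
      ≡⟨ ∑ᵛ-cong (V.map bitsBelow U) (λ M → solve 4 (λ c s a x → c :* (s :+ a :* x) := c :* s :+ a :* (c :* x)) refl
           (topFactor U M) (∑[ k < N ] (a k * X k (U ∖ M))) (a N) (X N (U ∖ M))) ⟩
    ∑[ M ⊆ U ] (topFactor U M * ∑[ k < N ] (a k * X k (U ∖ M)) + a N * (topFactor U M * X N (U ∖ M)))
      ≡⟨ ∑ᵛ-distrib-+ (V.map bitsBelow U) (λ M → topFactor U M * ∑[ k < N ] (a k * X k (U ∖ M)))
                                          (λ M → a N * (topFactor U M * X N (U ∖ M))) ⟩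
    topTransfer (λ V → ∑[ k < N ] (a k * X k V)) U + ∑[ M ⊆ U ] (a N * (topFactor U M * X N (U ∖ M)))
      ≡⟨ cong₂ _+_ (topTransfer-∑< N a X U) (sym (∑ᵛ-distribˡ (V.map bitsBelow U) (a N) (λ M → topFactor U M * X N (U ∖ M)))) ⟩
    ∑[ k < N ] (a k * topTransfer (X k) U) + a N * topTransfer (X N) U ∎

  -- Δ k is the k-th forward difference of q ↦ Z U q at q = 0.
  Δ : ℕ → Subset n → ℚ
  Δ zero    U = δ∅ U
  Δ (suc k) U = topTransfer (Δ k) U - Δ k U

  Δ-vanishes : ∀ k U → size U < k → Δ k U ≡ 0ℚ
  Δ-vanishes (suc k) U (s≤s |U|≤k) =
    trans (cong (_- Δ k U) (∑⊆-unitriangular topFactor U (Δ k) (peelingFactor-∅ D (topArc up flat down) (λ _ _ → refl) U) smaller))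
          (+-inverseʳ (Δ k U))
    where
    smaller : ∀ M → M ⊆ U → isEmpty M ≡ false → Δ k (U ∖ M) ≡ 0ℚ
    smaller M M⊆U M≢∅ = Δ-vanishes k (U ∖ M) (ℕP.<-≤-trans (size-∖-nonempty U M M⊆U M≢∅) |U|≤k)

  Zpoly : Subset n → ℚ → ℚ
  Zpoly U x = ∑[ k < suc n ] (x choose k * Δ k U)

  isPolynomial-Zpoly : ∀ U → IsPolynomial (Zpoly U)
  isPolynomial-Zpoly U = isPolynomial-∑< (suc n) (λ k x → x choose k * Δ k U)
                           (λ k → isPolynomial-* (isPolynomial-choose k) (isPolynomial-const (Δ k U)))

  Zpoly-suc : ∀ x U → Zpoly U (x + 1ℚ) ≡ topTransfer (λ V → Zpoly V x) U
  Zpoly-suc x U = begin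
    Zpoly U (x + 1ℚ)
      ≡⟨ ∑<-pascal n (λ k → Δ k U) x ⟩
    ∑[ k < suc n ] (x choose k * Δ k U) + ∑[ k < n ] (x choose k * (topTransfer (Δ k) U - Δ k U))
      ≡⟨ cong (∑[ k < suc n ] (x choose k * Δ k U) +_) (∑<-distrib-- n (x choose_) (λ k → topTransfer (Δ k) U) (λ k → Δ k U)) ⟩
    (S + x choose n * Δ n U) + (S' - S)
      ≡⟨ solve 4 (λ S b d S' → (S :+ b :* d) :+ (S' :- S) := S' :+ b :* d) refl S (x choose n) (Δ n U) S' ⟩
    S' + x choose n * Δ n U
      ≡⟨ cong (λ z → S' + x choose n * z) (sym (p-q≡0⇒p≡q (topTransfer (Δ n) U) (Δ n U) (Δ-vanishes (suc n) U (s≤s (size≤n U))))) ⟩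
    S' + x choose n * topTransfer (Δ n) U
      ≡⟨ sym (topTransfer-∑< (suc n) (x choose_) Δ U) ⟩
    topTransfer (λ V → Zpoly V x) U ∎
    where
    S S' : ℚ
    S  = ∑[ k < n ] (x choose k * Δ k U)
    S' = ∑[ k < n ] (x choose k * topTransfer (Δ k) U)

  Zpoly-ℕ : ∀ q U → Zpoly U (ℕ→ℚ q) ≡ Z U q
  Zpoly-ℕ zero    U = trans (∑<-0-choose n (λ k → Δ k U)) (sym (Z-zero U))
  Zpoly-ℕ (suc q) U = begin
    Zpoly U (ℕ→ℚ (suc q))                     ≡⟨ cong (Zpoly U) (ℕ→ℚ-suc q) ⟩
    Zpoly U (ℕ→ℚ q + 1ℚ)                      ≡⟨ Zpoly-suc (ℕ→ℚ q) U ⟩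
    topTransfer (λ V → Zpoly V (ℕ→ℚ q)) U     ≡⟨ topTransfer-cong (λ V → Zpoly-ℕ q V) U ⟩
    topTransfer (λ V → Z V q) U               ≡⟨ sym (Z-suc-top U q) ⟩
    Z U (suc q)                               ∎

  module Reciprocity (Y : Subset n → ℕ → ℚ) (d : Subset n → Subset n → ℚ)
    (Y-zero : ∀ U → Y U 0 ≡ δ∅ U)
    (Y-suc : ∀ U q → Y U (suc q) ≡ ∑[ M ⊆ U ] (d U M * Y (U ∖ M) q))
    (inverse : ∀ U T → T ⊆ U → ∑[ M ⊆ T ] (sign M * topFactor U M * d (U ∖ M) (T ∖ M)) ≡ δ∅ T) where

    signedTransfer : (Subset n → ℚ) → Subset n → ℚ
    signedTransfer X U = ∑[ M ⊆ U ] ((sign M * topFactor U M) * X (U ∖ M))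

    signedTransfer-Zpoly : ∀ x U → sign U * Zpoly U (x + 1ℚ) ≡ signedTransfer (λ V → sign V * Zpoly V x) U
    signedTransfer-Zpoly x U = begin
      sign U * Zpoly U (x + 1ℚ)                 ≡⟨ cong (sign U *_) (Zpoly-suc x U) ⟩
      sign U * topTransfer (λ V → Zpoly V x) U  ≡⟨ ∑ᵛ-distribˡ (V.map bitsBelow U) (sign U) (λ M → topFactor U M * Zpoly (U ∖ M) x) ⟩
      ∑[ M ⊆ U ] (sign U * (topFactor U M * Zpoly (U ∖ M) x))
        ≡⟨ ∑ᵛ-cong∈ (V.map bitsBelow U) (λ M M⊆U → trans (cong (_* (topFactor U M * Zpoly (U ∖ M) x)) (sign-∖ U M M⊆U))
             (solve 4 (λ s t c e → (s :* t) :* (c :* e) := (s :* c) :* (t :* e)) refl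
               (sign M) (sign (U ∖ M)) (topFactor U M) (Zpoly (U ∖ M) x))) ⟩
      signedTransfer (λ V → sign V * Zpoly V x) U ∎

    signedTransfer-Y : ∀ q U → signedTransfer (λ V → Y V (suc q)) U ≡ Y U q
    signedTransfer-Y q U = begin
      ∑[ M₁ ⊆ U ] ((sign M₁ * topFactor U M₁) * Y (U ∖ M₁) (suc q))
        ≡⟨ ∑ᵛ-cong (V.map bitsBelow U) (λ M₁ → trans (cong ((sign M₁ * topFactor U M₁) *_) (Y-suc (U ∖ M₁) q))
             (∑ᵛ-distribˡ (V.map bitsBelow (U ∖ M₁)) (sign M₁ * topFactor U M₁) (λ M₂ → d (U ∖ M₁) M₂ * Y (U ∖ M₁ ∖ M₂) q))) ⟩
      ∑[ M₁ ⊆ U ] ∑[ M₂ ⊆ U ∖ M₁ ] ((sign M₁ * topFactor U M₁) * (d (U ∖ M₁) M₂ * Y (U ∖ M₁ ∖ M₂) q))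
        ≡⟨ ∑⊆-∑⊆-regroup U (λ M₁ M₂ → (sign M₁ * topFactor U M₁) * (d (U ∖ M₁) M₂ * Y (U ∖ M₁ ∖ M₂) q)) ⟩
      ∑[ T ⊆ U ] ∑[ M₁ ⊆ T ] ((sign M₁ * topFactor U M₁) * (d (U ∖ M₁) (T ∖ M₁) * Y (U ∖ M₁ ∖ (T ∖ M₁)) q))
        ≡⟨ ∑ᵛ-cong∈ (V.map bitsBelow U) collapse ⟩
      ∑[ T ⊆ U ] (δ∅ T * Y (U ∖ T) q)
        ≡⟨ ∑ᵛ-cong (V.map bitsBelow U) (λ T → δ∅-absorbs-∖ U T (λ V → Y V q)) ⟩
      ∑[ T ⊆ U ] (δ∅ T * Y U q)
        ≡⟨ ∑⊆-δ∅ U (Y U q) ⟩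
      Y U q ∎
      where
      collapse : ∀ T → T ⊆ U → ∑[ M₁ ⊆ T ] ((sign M₁ * topFactor U M₁) * (d (U ∖ M₁) (T ∖ M₁) * Y (U ∖ M₁ ∖ (T ∖ M₁)) q))
                             ≡ δ∅ T * Y (U ∖ T) q
      collapse T T⊆U = begin
        ∑[ M₁ ⊆ T ] ((sign M₁ * topFactor U M₁) * (d (U ∖ M₁) (T ∖ M₁) * Y (U ∖ M₁ ∖ (T ∖ M₁)) q))
          ≡⟨ ∑ᵛ-cong∈ (V.map bitsBelow T) (λ M₁ M₁⊆T → trans
               (cong (λ V → (sign M₁ * topFactor U M₁) * (d (U ∖ M₁) (T ∖ M₁) * Y V q)) (∖-∖ U T M₁ T⊆U M₁⊆T))
               (solve 3 (λ s d y → s :* (d :* y) := y :* (s :* d)) refl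
                  (sign M₁ * topFactor U M₁) (d (U ∖ M₁) (T ∖ M₁)) (Y (U ∖ T) q))) ⟩
        ∑[ M₁ ⊆ T ] (Y (U ∖ T) q * (sign M₁ * topFactor U M₁ * d (U ∖ M₁) (T ∖ M₁)))
          ≡⟨ sym (∑ᵛ-distribˡ (V.map bitsBelow T) (Y (U ∖ T) q) (λ M₁ → sign M₁ * topFactor U M₁ * d (U ∖ M₁) (T ∖ M₁))) ⟩
        Y (U ∖ T) q * ∑[ M₁ ⊆ T ] (sign M₁ * topFactor U M₁ * d (U ∖ M₁) (T ∖ M₁))
          ≡⟨ cong (Y (U ∖ T) q *_) (inverse U T T⊆U) ⟩
        Y (U ∖ T) q * δ∅ T
          ≡⟨ *-comm (Y (U ∖ T) q) (δ∅ T) ⟩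
        δ∅ T * Y (U ∖ T) q ∎

    signedTransfer-injective : ∀ (X X' : Subset n → ℚ) → (∀ U → signedTransfer X U ≡ signedTransfer X' U) →
                               ∀ k U → size U < k → X U ≡ X' U
    signedTransfer-injective X X' eq (suc k) U (s≤s |U|≤k) = p-q≡0⇒p≡q (X U) (X' U) (begin
      X U - X' U                                        ≡⟨ sym (∑⊆-unitriangular (λ U M → sign M * topFactor U M) U X-X' kernel-∅ smaller) ⟩
      ∑[ M ⊆ U ] ((sign M * topFactor U M) * X-X' (U ∖ M))
        ≡⟨ ∑ᵛ-cong (V.map bitsBelow U) (λ M → solve 3 (λ t x x' → t :* (x :- x') := t :* x :+ :- (t :* x')) refl
             (sign M * topFactor U M) (X (U ∖ M)) (X' (U ∖ M))) ⟩
      ∑[ M ⊆ U ] ((sign M * topFactor U M) * X (U ∖ M) + - ((sign M * topFactor U M) * X' (U ∖ M)))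
        ≡⟨ ∑ᵛ-distrib-+ (V.map bitsBelow U) (λ M → (sign M * topFactor U M) * X (U ∖ M)) (λ M → - ((sign M * topFactor U M) * X' (U ∖ M))) ⟩
      signedTransfer X U + ∑[ M ⊆ U ] (- ((sign M * topFactor U M) * X' (U ∖ M)))
        ≡⟨ cong₂ _+_ (eq U) (∑ᵛ-neg (V.map bitsBelow U) (λ M → (sign M * topFactor U M) * X' (U ∖ M))) ⟩
      signedTransfer X' U - signedTransfer X' U         ≡⟨ +-inverseʳ (signedTransfer X' U) ⟩
      0ℚ                                                ∎)
      where
      X-X' : Subset n → ℚ
      X-X' V = X V - X' V
      kernel-∅ : sign (∅ {n}) * topFactor U ∅ ≡ 1ℚ
      kernel-∅ = trans (cong₂ _*_ (sign-∅ n) (peelingFactor-∅ D (topArc up flat down) (λ _ _ → refl) U)) (*-identityˡ 1ℚ)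
      smaller : ∀ M → M ⊆ U → isEmpty M ≡ false → X-X' (U ∖ M) ≡ 0ℚ
      smaller M M⊆U M≢∅ = trans (cong (_- X' (U ∖ M)) (signedTransfer-injective X X' eq k (U ∖ M)
                                   (ℕP.<-≤-trans (size-∖-nonempty U M M⊆U M≢∅) |U|≤k)))
                                (+-inverseʳ (X' (U ∖ M)))

    reciprocity : ∀ q U → sign U * Zpoly U (- ℕ→ℚ q) ≡ Y U q
    reciprocity zero    U = trans (cong (sign U *_) (Zpoly-ℕ zero U))
                              (trans (cong (sign U *_) (Z-zero U)) (trans (sign*δ∅ U) (sym (Y-zero U))))
    reciprocity (suc q) U = signedTransfer-injective (λ V → sign V * Zpoly V (- ℕ→ℚ (suc q))) (λ V → Y V (suc q))
      (λ V → trans (sym (stepped V)) (trans (reciprocity q V) (sym (signedTransfer-Y q V)))) (suc n) U (s≤s (size≤n U))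
      where
      -q≡-[q+1]+1 : - ℕ→ℚ q ≡ - ℕ→ℚ (suc q) + 1ℚ
      -q≡-[q+1]+1 = trans (solve 1 (λ a → :- a := :- (a :+ 𝟙) :+ 𝟙) refl (ℕ→ℚ q))
                          (cong (λ z → - z + 1ℚ) (sym (ℕ→ℚ-suc q)))
      stepped : ∀ V → sign V * Zpoly V (- ℕ→ℚ q) ≡ signedTransfer (λ V → sign V * Zpoly V (- ℕ→ℚ (suc q))) V
      stepped V = trans (cong (λ x → sign V * Zpoly V x) -q≡-[q+1]+1) (signedTransfer-Zpoly (- ℕ→ℚ (suc q)) V)

-- Cycles closed by walks

module Walk {n m : ℕ} (D : Digraph n m) {X : Set} (vertex : X → Fin n) (next : X → X) (arcOf : X → Fin m)
            (start : X) where

  walk : ℕ → X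
  walk zero    = start
  walk (suc k) = next (walk k)

  position : ℕ → Fin n
  position k = vertex (walk k)

  private
    position′ : Fin (suc n) → Fin n
    position′ k = position (toℕ k)

    Repeats : Fin (suc n) → Set
    Repeats j = ∃ λ i → i Fin.< j × position′ i ≡ position′ j

    repeats? : ∀ j → Dec.Dec (Repeats j)
    repeats? j = FinP.any? (λ i → (i FinP.<? j) Dec.×-dec (position′ i FinP.≟ position′ j))

  repetition : ∃₂ λ i j → i < j × position i ≡ position j
  repetition with FinP.pigeonhole ℕP.≤-refl position′
  ... | i , j , i<j , eq = toℕ i , toℕ j , i<j , eq

  firstRepetition : Σ ℕ λ i → Σ ℕ λ j → i < j × position i ≡ position j × (∀ a b → a < b → b < j → position a ≢ position b)
  firstRepetition = toℕ i₀ , toℕ j₀ , i₀<j₀ , eq , injective-below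
    where
    smallest : Σ (Fin (suc n)) λ j → ¬ ¬ Repeats j × (∀ (k : Fin (toℕ j)) → ¬ Repeats (inject k))
    smallest = FinP.¬∀⟶∃¬-smallest (suc n) (λ j → ¬ Repeats j) (λ j → Dec.¬? (repeats? j))
                 (λ none → let (i , j , i<j , eq) = FinP.pigeonhole ℕP.≤-refl position′ in none j (i , i<j , eq))
    j₀ : Fin (suc n)
    j₀ = proj₁ smallest
    repeats-j₀ : Repeats j₀
    repeats-j₀ = Dec.decidable-stable (repeats? j₀) (proj₁ (proj₂ smallest))
    i₀ : Fin (suc n)
    i₀ = proj₁ repeats-j₀
    i₀<j₀ : toℕ i₀ < toℕ j₀
    i₀<j₀ = proj₁ (proj₂ repeats-j₀)
    eq : position (toℕ i₀) ≡ position (toℕ j₀)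
    eq = proj₂ (proj₂ repeats-j₀)
    injective-below : ∀ a b → a < b → b < toℕ j₀ → position a ≢ position b
    injective-below a b a<b b<j₀ pa≡pb = proj₂ (proj₂ smallest) b′ (fromℕ< a<n , a<b′ , position-a≡b′)
      where
      b′ : Fin (toℕ j₀)
      b′ = fromℕ< b<j₀
      toℕb′ : toℕ (inject b′) ≡ b
      toℕb′ = trans (FinP.toℕ-inject b′) (FinP.toℕ-fromℕ< b<j₀)
      a<n : a < suc n
      a<n = ℕP.<-trans a<b (ℕP.<-trans b<j₀ (FinP.toℕ<n j₀))
      a<b′ : fromℕ< a<n Fin.< inject b′
      a<b′ = subst₂ ℕ._<_ (sym (FinP.toℕ-fromℕ< a<n)) (sym toℕb′) a<b
      position-a≡b′ : position′ (fromℕ< a<n) ≡ position′ (inject b′)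
      position-a≡b′ = trans (cong position (FinP.toℕ-fromℕ< a<n)) (trans pa≡pb (cong position (sym toℕb′)))

  directedClosedWalk : (∀ y → D (arcOf y) ≡ (vertex y , vertex (next y))) → ∃ λ v → TransClosure (ArcRel D) v v
  directedClosedWalk forward with repetition
  ... | i , j , i<j , eq = position i , subst (TransClosure (ArcRel D) (position i)) (trans (cong position i+[j-i]≡j) (sym eq)) (path i (j ∸ suc i))
    where
    step : ∀ k → ArcRel D (position k) (position (suc k))
    step k = arcOf (walk k) , forward (walk k)
    path : ∀ k d → TransClosure (ArcRel D) (position k) (position (k ℕ.+ suc d))
    path k zero    = subst (TransClosure (ArcRel D) (position k)) (cong position (ℕP.+-comm 1 k)) [ step k ]
    path k (suc d) = step k ∷ subst (TransClosure (ArcRel D) (position (suc k))) (cong position (sym (ℕP.+-suc k (suc d)))) (path (suc k) d)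
    i+[j-i]≡j : i ℕ.+ suc (j ∸ suc i) ≡ j
    i+[j-i]≡j = trans (ℕP.+-suc i (j ∸ suc i)) (ℕP.m+[n∸m]≡n i<j)

  closedWalkCycle : (∀ y → Joins (D (arcOf y)) (vertex y) (vertex (next y))) →
                    (∀ {y z} → arcOf y ≡ arcOf z → vertex y ≡ vertex z) → UCycle D
  closedWalkCycle joins arcOf-determines with firstRepetition
  ... | i , j , i<j , eq , injective-below = record
    { k = k ; vs = vs ; es = es ; vs-inj = vs-injective ; es-inj = λ e → vs-injective (arcOf-determines e) ; step = step ; close = close }
    where
    k : ℕ
    k = j ∸ suc i
    i+[k+1]≡j : i ℕ.+ suc k ≡ j
    i+[k+1]≡j = trans (ℕP.+-suc i k) (ℕP.m+[n∸m]≡n i<j)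
    below-j : ∀ (t : Fin (suc k)) → i ℕ.+ toℕ t < j
    below-j t = subst (i ℕ.+ toℕ t <_) i+[k+1]≡j (ℕP.+-monoʳ-< i (FinP.toℕ<n t))
    vs : Fin (suc k) → Fin n
    vs t = position (i ℕ.+ toℕ t)
    es : Fin (suc k) → Fin m
    es t = arcOf (walk (i ℕ.+ toℕ t))
    vs-injective : ∀ {a b} → vs a ≡ vs b → a ≡ b
    vs-injective {a} {b} e with ℕP.<-cmp (toℕ a) (toℕ b)
    ... | tri< a<b _ _ = ⊥-elim (injective-below (i ℕ.+ toℕ a) (i ℕ.+ toℕ b) (ℕP.+-monoʳ-< i a<b) (below-j b) e)
    ... | tri≈ _ a≡b _ = FinP.toℕ-injective a≡b
    ... | tri> _ _ b<a = ⊥-elim (injective-below (i ℕ.+ toℕ b) (i ℕ.+ toℕ a) (ℕP.+-monoʳ-< i b<a) (below-j a) (sym e))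
    joins-at : ∀ l → Joins (D (arcOf (walk l))) (position l) (position (suc l))
    joins-at l = joins (walk l)
    step : (t : Fin k) → Joins (D (es (inject₁ t))) (vs (inject₁ t)) (vs (suc t))
    step t = subst (λ z → Joins (D (arcOf (walk (i ℕ.+ z)))) (position (i ℕ.+ z)) (position (i ℕ.+ suc (toℕ t)))) (sym (FinP.toℕ-inject₁ t))
               (subst (λ z → Joins (D (arcOf (walk (i ℕ.+ toℕ t)))) (position (i ℕ.+ toℕ t)) (position z)) (sym (ℕP.+-suc i (toℕ t)))
                 (joins-at (i ℕ.+ toℕ t)))
    closes : position (suc (i ℕ.+ k)) ≡ position (i ℕ.+ 0)
    closes = trans (cong position (trans (sym (ℕP.+-suc i k)) i+[k+1]≡j)) (trans (sym eq) (cong position (sym (ℕP.+-identityʳ i))))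
    close : Joins (D (es (fromℕ k))) (vs (fromℕ k)) (vs zero)
    close = subst (λ z → Joins (D (arcOf (walk (i ℕ.+ z)))) (position (i ℕ.+ z)) (position (i ℕ.+ 0))) (sym (FinP.toℕ-fromℕ k))
              (subst (Joins (D (arcOf (walk (i ℕ.+ k)))) (position (i ℕ.+ k))) closes (joins-at (i ℕ.+ k)))

-- The inversion formula, by a sign-reversing involution

data Pick : Set where
  none atTail atHead : Pick

allPicks : List Pick
allPicks = none ∷ atTail ∷ atHead ∷ []

pickedVertex : ∀ {n m} → Digraph n m → Fin m → Pick → Maybe (Fin n)
pickedVertex D i none   = nothing
pickedVertex D i atTail = just (tailOf D i)
pickedVertex D i atHead = just (headOf D i)

indicator : Bool → ℚ
indicator true  = 1ℚ
indicator false = 0ℚ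

memberᵐ : ∀ {n} → Subset n → Maybe (Fin n) → ℚ
memberᵐ M nothing  = 1ℚ
memberᵐ M (just v) = indicator (lookup M v)

FreeVertex : ∀ {n m} → Digraph n m → Subset n → Vec Pick m → Set
FreeVertex {n} D T φ = Σ (Fin n) λ v → lookup T v ≡ true × (∀ i → pickedVertex D i (lookup φ i) ≢ just v)

arcPolynomial : ∀ {n m} → Digraph n m → (Fin m → Pick → ℚ) → Fin m → Subset n → ℚ
arcPolynomial D coeff i M = ∑ allPicks (λ p → coeff i p * memberᵐ M (pickedVertex D i p))

module SignReversal {n m : ℕ} (D : Digraph n m) (T : Subset n) (coeff : Fin m → Pick → ℚ)
  (free : ∀ φ → (∀ i → coeff i (lookup φ i) ≢ 0ℚ) → FreeVertex D T φ) where

  private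
    term : Vec Pick m → Subset n → ℚ
    term φ M = ∏ (λ i → coeff i (lookup φ i) * memberᵐ M (pickedVertex D i (lookup φ i)))

    -- Toggling a free vertex v reverses the sign and keeps the term.
    term-vanishes : ∀ φ → ∑[ M ⊆ T ] (sign M * term φ M) ≡ 0ℚ
    term-vanishes φ with FinP.any? (λ i → coeff i (lookup φ i) ≟ 0ℚ)
    ... | yes (i , cᵢ≡0) = ∑ᵛ-zero∈ (V.map bitsBelow T) (λ M → sign M * term φ M) (λ M _ →
          trans (cong (sign M *_) (∏-zero _ i (trans (cong (_* memberᵐ M (pickedVertex D i (lookup φ i))) cᵢ≡0)
                                                    (*-zeroˡ (memberᵐ M (pickedVertex D i (lookup φ i)))))))
                (*-zeroʳ (sign M)))
    ... | no ¬zero = ∑ᵛ-sign-reversing (V.map bitsBelow T) v not toggle-permutes (λ M → sign M * term φ M) reverses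
      where
      freeVertex : FreeVertex D T φ
      freeVertex = free φ (λ i cᵢ≡0 → ¬zero (i , cᵢ≡0))
      v : Fin n
      v = proj₁ freeVertex
      v∈T : lookup T v ≡ true
      v∈T = proj₁ (proj₂ freeVertex)
      v-free : ∀ i → pickedVertex D i (lookup φ i) ≢ just v
      v-free = proj₂ (proj₂ freeVertex)
      toggle-permutes : ∀ f → ∑ (lookup (V.map bitsBelow T) v) f ≡ ∑ (lookup (V.map bitsBelow T) v) (λ b → f (not b))
      toggle-permutes f rewrite lookup-map v bitsBelow T | v∈T =
        solve 2 (λ a b → a :+ (b :+ 𝟘) := b :+ (a :+ 𝟘)) refl (f false) (f true)
      member-unchanged : ∀ M (w : Maybe (Fin n)) → w ≢ just v → memberᵐ (updateAt M v not) w ≡ memberᵐ M w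
      member-unchanged M nothing  _     = refl
      member-unchanged M (just w) w≢v = cong indicator (lookup∘updateAt′ w v (λ w≡v → w≢v (cong just w≡v)) M)
      reverses : ∀ M → M ⊆ T → sign (updateAt M v not) * term φ (updateAt M v not) ≡ - (sign M * term φ M)
      reverses M _ = trans (cong₂ _*_ (sign-flip v M) (∏-cong (λ i → cong (coeff i (lookup φ i) *_)
                             (member-unchanged M (pickedVertex D i (lookup φ i)) (v-free i)))))
                           (sym (neg-distribˡ-* (sign M) (term φ M)))

  signed-∏-vanishes : ∑[ M ⊆ T ] (sign M * ∏ (λ i → arcPolynomial D coeff i M)) ≡ 0ℚ
  signed-∏-vanishes = begin
    ∑[ M ⊆ T ] (sign M * ∏ (λ i → arcPolynomial D coeff i M))
      ≡⟨ ∑ᵛ-cong (V.map bitsBelow T) (λ M → cong (sign M *_) (∏-distrib-∑ m allPicks (λ i p → coeff i p * memberᵐ M (pickedVertex D i p)))) ⟩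
    ∑[ M ⊆ T ] (sign M * ∑ᵛ (replicate m allPicks) (λ φ → term φ M))
      ≡⟨ ∑ᵛ-cong (V.map bitsBelow T) (λ M → ∑ᵛ-distribˡ (replicate m allPicks) (sign M) (λ φ → term φ M)) ⟩
    ∑[ M ⊆ T ] ∑ᵛ (replicate m allPicks) (λ φ → sign M * term φ M)
      ≡⟨ ∑ᵛ-comm (V.map bitsBelow T) (replicate m allPicks) (λ M φ → sign M * term φ M) ⟩
    ∑ᵛ (replicate m allPicks) (λ φ → ∑[ M ⊆ T ] (sign M * term φ M))
      ≡⟨ trans (∑ᵛ-cong (replicate m allPicks) term-vanishes) (∑ᵛ-zero (replicate m allPicks)) ⟩
    0ℚ ∎

otherEnd : ∀ {n m} → Digraph n m → Fin m → Pick → Fin n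
otherEnd D i atTail = headOf D i
otherEnd D i _      = tailOf D i

picked-joins : ∀ {n m} (D : Digraph n m) i p {v} → pickedVertex D i p ≡ just v → Joins (D i) v (otherEnd D i p)
picked-joins D i atTail refl = inj₁ (refl , refl)
picked-joins D i atHead refl = inj₂ (refl , refl)

picked-forward : ∀ {n m} (D : Digraph n m) i p {v} → p ≢ atHead → pickedVertex D i p ≡ just v → D i ≡ (v , otherEnd D i p)
picked-forward D i atTail _     refl = refl
picked-forward D i atHead ¬head refl = ⊥-elim (¬head refl)

Inside : ∀ {n m} → Digraph n m → Subset n → Vec Pick m → Set
Inside D T φ = ∀ i → lookup φ i ≢ none → lookup T (tailOf D i) ≡ true × lookup T (headOf D i) ≡ true

module Picks {n m : ℕ} (D : Digraph n m) (T : Subset n) (φ : Vec Pick m) (inside : Inside D T φ)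
  (v₀ : Fin n) (v₀∈T : lookup T v₀ ≡ true) where

  private
    PickedBy : Fin n → Fin m → Set
    PickedBy v i = pickedVertex D i (lookup φ i) ≡ just v

    picked? : ∀ v → Dec.Dec (∃ (PickedBy v))
    picked? v = FinP.any? (λ i → MaybeP.≡-dec FinP._≟_ (pickedVertex D i (lookup φ i)) (just v))

    covered-or-free : (∀ v → lookup T v ≡ true → ∃ (PickedBy v)) ⊎ FreeVertex D T φ
    covered-or-free with FinP.any? (λ v → (lookup T v BoolP.≟ true) Dec.×-dec Dec.¬? (picked? v))
    ... | yes (v , v∈T , unpicked) = inj₂ (v , v∈T , λ i picked → unpicked (i , picked))
    ... | no  no-free = inj₁ (λ v v∈T → Dec.decidable-stable (picked? v) (λ unpicked → no-free (v , v∈T , unpicked)))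

    module Covered (cover : ∀ v → lookup T v ≡ true → ∃ (PickedBy v)) where
      Vertex : Set
      Vertex = Σ (Fin n) λ v → lookup T v ≡ true

      arcOf : Vertex → Fin m
      arcOf (v , v∈T) = proj₁ (cover v v∈T)

      arcOf-picks : ∀ x → PickedBy (proj₁ x) (arcOf x)
      arcOf-picks (v , v∈T) = proj₂ (cover v v∈T)

      otherEnd-inside : ∀ i {v} → PickedBy v i → lookup T (otherEnd D i (lookup φ i)) ≡ true
      otherEnd-inside i picked with lookup φ i | inside i
      otherEnd-inside i ()     | none   | _
      otherEnd-inside i picked | atTail | inside-i = proj₂ (inside-i (λ ()))
      otherEnd-inside i picked | atHead | inside-i = proj₁ (inside-i (λ ()))

      next : Vertex → Vertex
      next x = otherEnd D (arcOf x) (lookup φ (arcOf x)) , otherEnd-inside (arcOf x) (arcOf-picks x)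

      open Walk D proj₁ next arcOf (v₀ , v₀∈T) public

  free-vertex-forest : UnderlyingForest D → FreeVertex D T φ
  free-vertex-forest forest with covered-or-free
  ... | inj₂ free  = free
  ... | inj₁ cover = ⊥-elim (forest (closedWalkCycle
          (λ x → picked-joins D (arcOf x) (lookup φ (arcOf x)) (arcOf-picks x))
          (λ {x} {y} same-arc → MaybeP.just-injective (trans (sym (arcOf-picks x)) (trans (cong (λ i → pickedVertex D i (lookup φ i)) same-arc) (arcOf-picks y))))))
    where open Covered cover

  free-vertex-acyclic : Acyclic D → (∀ i → lookup φ i ≢ atHead) → FreeVertex D T φ
  free-vertex-acyclic acyclic tails-only with covered-or-free
  ... | inj₂ free  = free
  ... | inj₁ cover = ⊥-elim (acyclic (proj₁ closed) (proj₂ closed))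
    where
    open Covered cover
    closed : ∃ λ v → TransClosure (ArcRel D) v v
    closed = directedClosedWalk (λ x → picked-forward D (arcOf x) (lookup φ (arcOf x)) (tails-only (arcOf x)) (arcOf-picks x))

data Nested : Bool → Bool → Bool → Set where
  inM     : Nested true  true  true
  inT     : Nested false true  true
  inU     : Nested false false true
  outside : Nested false false false

nested : ∀ {b t u} → b ∈ bitsBelow t → t ∈ bitsBelow u → Nested b t u
nested {true}  {true}  {true}  _ _ = inM
nested {false} {true}  {true}  _ _ = inT
nested {false} {false} {true}  _ _ = inU
nested {false} {false} {false} _ _ = outside
nested {true}  {false} (here ())  _
nested {true}  {false} (there ()) _
nested {_}     {true}  {false} _ (here ())
nested {_}     {true}  {false} _ (there ())

both : ℚ → Bool → Bool → ℚ
both c true  true  = c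
both c true  false = 0ℚ
both c false _     = 0ℚ

both-nonzero : ∀ {c} b b′ → both c b b′ ≢ 0ℚ → b ≡ true × b′ ≡ true
both-nonzero true  true  _ = refl , refl
both-nonzero true  false ≢0 = ⊥-elim (≢0 refl)
both-nonzero false _     ≢0 = ⊥-elim (≢0 refl)

-- On a single arc, the product of the two kernels is affine in the
-- membership in M of its endpoints; the tail and head coefficients vanish
-- unless the arc lies inside T.
AffineOnArcs : ArcRule → ArcRule → ℚ → ℚ → Set
AffineOnArcs outer inner cTail cHead = ∀ {bt Tt Ut bh Th Uh} → Nested bt Tt Ut → Nested bh Th Uh →
  outer bt bh Ut Uh * inner (Tt ∖ᵇ bt) (Th ∖ᵇ bh) (Ut ∖ᵇ bt) (Uh ∖ᵇ bh)
  ≡ outer false false Ut Uh * inner Tt Th Ut Uh + both cTail Tt Th * indicator bt + both cHead Tt Th * indicator bh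

affine-outside-M : ∀ p q r → p ≡ p + q * indicator false + r * indicator false
affine-outside-M = solve 3 (λ p q r → p := p :+ q :* 𝟘 :+ r :* 𝟘) refl

module InverseKernel {n m : ℕ} (D : Digraph n m) (outer inner : ArcRule) (cTail cHead : ℚ)
  (local : AffineOnArcs outer inner cTail cHead)
  (outer-∅ : ∀ ut uh → outer false false ut uh ≡ 1ℚ)
  (inner-∅ : ∀ ut uh → inner false false ut uh ≡ 1ℚ)
  (free : ∀ (T : Subset n) φ v₀ → lookup T v₀ ≡ true → Inside D T φ →
          (∀ i → lookup φ i ≡ atHead → cHead ≢ 0ℚ) → FreeVertex D T φ) where

  private
    summand : Subset n → Subset n → Subset n → ℚ
    summand U T M = sign M * peelingFactor D outer U M * peelingFactor D inner (U ∖ M) (T ∖ M)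

  inverse-∅ : ∀ U → ∑[ M ⊆ ∅ ] summand U ∅ M ≡ 1ℚ
  inverse-∅ U = begin
    ∑[ M ⊆ ∅ ] summand U ∅ M
      ≡⟨ ∑⊆-∅ n (summand U ∅) ⟩
    sign (∅ {n}) * peelingFactor D outer U ∅ * peelingFactor D inner (U ∖ ∅) (∅ ∖ ∅)
      ≡⟨ cong₂ (λ s p → s * peelingFactor D outer U ∅ * p) (sign-∅ n)
           (trans (cong (peelingFactor D inner (U ∖ ∅)) (∖-∅ ∅)) (peelingFactor-∅ D inner inner-∅ (U ∖ ∅))) ⟩
    1ℚ * peelingFactor D outer U ∅ * 1ℚ
      ≡⟨ cong (λ p → 1ℚ * p * 1ℚ) (peelingFactor-∅ D outer outer-∅ U) ⟩
    1ℚ * 1ℚ * 1ℚ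
      ≡⟨ trans (*-identityʳ (1ℚ * 1ℚ)) (*-identityʳ 1ℚ) ⟩
    1ℚ ∎

  module _ (U T : Subset n) (T⊆U : T ⊆ U) where

    coeff : Fin m → Pick → ℚ
    coeff i none   = outer false false (lookup U (tailOf D i)) (lookup U (headOf D i))
                   * inner (lookup T (tailOf D i)) (lookup T (headOf D i)) (lookup U (tailOf D i)) (lookup U (headOf D i))
    coeff i atTail = both cTail (lookup T (tailOf D i)) (lookup T (headOf D i))
    coeff i atHead = both cHead (lookup T (tailOf D i)) (lookup T (headOf D i))

    summand-expands : ∀ M → M ⊆ T → summand U T M ≡ sign M * ∏ (λ i → arcPolynomial D coeff i M)
    summand-expands M M⊆T = trans
      (*-assoc (sign M) (peelingFactor D outer U M) (peelingFactor D inner (U ∖ M) (T ∖ M)))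
      (cong (sign M *_) (trans (sym (∏-distrib-* (arcFactor D outer U M) (arcFactor D inner (U ∖ M) (T ∖ M))))
                               (∏-cong per-arc)))
      where
      position : ∀ v → Nested (lookup M v) (lookup T v) (lookup U v)
      position v = nested (subst (lookup M v ∈_) (lookup-map v bitsBelow T) (Pointwise.lookup M⊆T v))
                          (subst (lookup T v ∈_) (lookup-map v bitsBelow U) (Pointwise.lookup T⊆U v))
      per-arc : ∀ i → arcFactor D outer U M i * arcFactor D inner (U ∖ M) (T ∖ M) i ≡ arcPolynomial D coeff i M
      per-arc i = begin
        outer bt bh Ut Uh * inner (lookup (T ∖ M) t) (lookup (T ∖ M) h) (lookup (U ∖ M) t) (lookup (U ∖ M) h)
          ≡⟨ cong₂ (λ x y → outer bt bh Ut Uh * inner (proj₁ x) (proj₂ x) (proj₁ y) (proj₂ y))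
               (cong₂ _,_ (lookup-zipWith _∖ᵇ_ t T M) (lookup-zipWith _∖ᵇ_ h T M))
               (cong₂ _,_ (lookup-zipWith _∖ᵇ_ t U M) (lookup-zipWith _∖ᵇ_ h U M)) ⟩
        outer bt bh Ut Uh * inner (Tt ∖ᵇ bt) (Th ∖ᵇ bh) (Ut ∖ᵇ bt) (Uh ∖ᵇ bh)
          ≡⟨ local (position t) (position h) ⟩
        coeff i none + coeff i atTail * indicator bt + coeff i atHead * indicator bh
          ≡⟨ solve 3 (λ a b c → a :+ b :+ c := a :* 𝟙 :+ (b :+ (c :+ 𝟘))) refl
               (coeff i none) (coeff i atTail * indicator bt) (coeff i atHead * indicator bh) ⟩
        arcPolynomial D coeff i M ∎
        where
        t h : Fin n
        t = tailOf D i
        h = headOf D i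
        bt bh Tt Th Ut Uh : Bool
        bt = lookup M t
        bh = lookup M h
        Tt = lookup T t
        Th = lookup T h
        Ut = lookup U t
        Uh = lookup U h

    inside : ∀ φ → (∀ i → coeff i (lookup φ i) ≢ 0ℚ) → Inside D T φ
    inside φ nonzero i picks with lookup φ i | nonzero i
    ... | none   | _    = ⊥-elim (picks refl)
    ... | atTail | c≢0 = both-nonzero (lookup T (tailOf D i)) (lookup T (headOf D i)) c≢0
    ... | atHead | c≢0 = both-nonzero (lookup T (tailOf D i)) (lookup T (headOf D i)) c≢0

    cHead≢0 : ∀ φ → (∀ i → coeff i (lookup φ i) ≢ 0ℚ) → ∀ i → lookup φ i ≡ atHead → cHead ≢ 0ℚ
    cHead≢0 φ nonzero i picks-head cHead≡0 =
      subst (λ p → coeff i p ≢ 0ℚ) picks-head (nonzero i) (trans (cong₂ (both cHead) tail∈T head∈T) cHead≡0)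
      where
      atHead≢none : atHead ≢ none
      atHead≢none ()
      endpoints∈T : lookup T (tailOf D i) ≡ true × lookup T (headOf D i) ≡ true
      endpoints∈T = inside φ nonzero i (λ picks-none → atHead≢none (trans (sym picks-head) picks-none))
      tail∈T : lookup T (tailOf D i) ≡ true
      tail∈T = proj₁ endpoints∈T
      head∈T : lookup T (headOf D i) ≡ true
      head∈T = proj₂ endpoints∈T

    inverse-nonempty : isEmpty T ≡ false → ∑[ M ⊆ T ] summand U T M ≡ 0ℚ
    inverse-nonempty T≢∅ = trans (∑ᵛ-cong∈ (V.map bitsBelow T) summand-expands) (SignReversal.signed-∏-vanishes D T coeff
      (λ φ nonzero → free T φ (proj₁ v₀) (proj₂ v₀) (inside φ nonzero) (cHead≢0 φ nonzero)))
      where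
      v₀ : Σ (Fin n) λ v → lookup T v ≡ true
      v₀ = nonempty T T≢∅

  inverse : ∀ U T → T ⊆ U → ∑[ M ⊆ T ] (sign M * peelingFactor D outer U M * peelingFactor D inner (U ∖ M) (T ∖ M)) ≡ δ∅ T
  inverse U T T⊆U with isEmpty T in empty
  ... | true  = trans (cong (λ T′ → ∑[ M ⊆ T′ ] summand U T′ M) (isEmpty⇒≡∅ T empty)) (inverse-∅ U)
  ... | false = inverse-nonempty U T T⊆U empty

-- The B-polynomial

∑-allFuns : ∀ n q (G : (Fin n → Fin q) → ℚ) → (∀ {f g} → (∀ x → f x ≡ g x) → G f ≡ G g) →
            ∑ (allFuns n q) G ≡ ∑ᵛ (replicate n (L.allFin q)) (λ v → G (lookup v))
∑-allFuns zero    q G G-ext = trans (+-identityʳ (G (λ ()))) (G-ext (λ ()))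
∑-allFuns (suc n) q G G-ext = cons-step _ (λ a f → refl) (λ a f i → refl)
  where
  cons-step : (cons : Fin q → (Fin n → Fin q) → (Fin (suc n) → Fin q)) →
              (∀ a f → cons a f zero ≡ a) → (∀ a f i → cons a f (suc i) ≡ f i) →
              ∑ (L.concatMap (λ a → L.map (cons a) (allFuns n q)) (L.allFin q)) G
              ≡ ∑ᵛ (replicate (suc n) (L.allFin q)) (λ v → G (lookup v))
  cons-step cons cons-zero cons-suc = begin
    ∑ (L.concatMap (λ a → L.map (cons a) (allFuns n q)) (L.allFin q)) G
      ≡⟨ ∑-concatMap (λ a → L.map (cons a) (allFuns n q)) (L.allFin q) G ⟩
    ∑ (L.allFin q) (λ a → ∑ (L.map (cons a) (allFuns n q)) G)
      ≡⟨ ∑-cong (L.allFin q) (λ a → trans (∑-map (cons a) (allFuns n q) G)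
           (trans (∑-allFuns n q (G ∘ cons a) (λ f≗g → G-ext (cons-cong a f≗g)))
                  (∑ᵛ-cong (replicate n (L.allFin q)) (λ v → G-ext (cons-lookup a v))))) ⟩
    ∑ (L.allFin q) (λ a → ∑ᵛ (replicate n (L.allFin q)) (λ v → G (lookup (a ∷ v)))) ∎
    where
    cons-cong : ∀ a {f g : Fin n → Fin q} → (∀ x → f x ≡ g x) → ∀ x → cons a f x ≡ cons a g x
    cons-cong a f≗g zero    = trans (cons-zero a _) (sym (cons-zero a _))
    cons-cong a f≗g (suc i) = trans (cons-suc a _ i) (trans (f≗g i) (sym (cons-suc a _ i)))
    cons-lookup : ∀ a v x → cons a (lookup v) x ≡ lookup (a ∷ v) x
    cons-lookup a v zero    = cons-zero a (lookup v)
    cons-lookup a v (suc i) = cons-suc a (lookup v) i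

∑ᵛ-replicate-map : ∀ {A B : Set} n (h : A → B) (xs : List A) (F : Vec B n → ℚ) →
                   ∑ᵛ (replicate n (L.map h xs)) F ≡ ∑ᵛ (replicate n xs) (λ v → F (V.map h v))
∑ᵛ-replicate-map zero    h xs F = refl
∑ᵛ-replicate-map (suc n) h xs F = trans (∑-map h xs (λ a → ∑ᵛ (replicate n (L.map h xs)) (λ v → F (a ∷ v))))
                                        (∑-cong xs (λ a → ∑ᵛ-replicate-map n h xs (λ v → F (h a ∷ v))))

pow-count : ∀ (c a b : ℚ) m (p p′ : Fin m → Bool) → (∀ i → p i ≡ true → p′ i ≡ false) →
            pow c m * (pow a (count p) * pow b (count p′)) ≡ ∏ (λ i → if p i then c * a else if p′ i then c * b else c)
pow-count c a b zero    p p′ disjoint = trans (*-identityˡ (1ℚ * 1ℚ)) (*-identityˡ 1ℚ)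
pow-count c a b (suc m) p p′ disjoint with p zero in p₀ | p′ zero in p′₀
... | true  | true  = ⊥-elim (true≢false (trans (sym p′₀) (disjoint zero p₀)))
  where
  true≢false : true ≢ false
  true≢false ()
... | true  | false = trans
  (solve 5 (λ c C a A B → (c :* C) :* ((a :* A) :* B) := (c :* a) :* (C :* (A :* B))) refl c (pow c m) a (pow a (count (p ∘ suc))) (pow b (count (p′ ∘ suc))))
  (cong ((c * a) *_) (pow-count c a b m (p ∘ suc) (p′ ∘ suc) (disjoint ∘ suc)))
... | false | true  = trans
  (solve 5 (λ c C b A B → (c :* C) :* (A :* (b :* B)) := (c :* b) :* (C :* (A :* B))) refl c (pow c m) b (pow a (count (p ∘ suc))) (pow b (count (p′ ∘ suc))))
  (cong ((c * b) *_) (pow-count c a b m (p ∘ suc) (p′ ∘ suc) (disjoint ∘ suc)))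
... | false | false = trans
  (solve 4 (λ c C A B → (c :* C) :* (A :* B) := c :* (C :* (A :* B))) refl c (pow c m) (pow a (count (p ∘ suc))) (pow b (count (p′ ∘ suc))))
  (cong (c *_) (pow-count c a b m (p ∘ suc) (p′ ∘ suc) (disjoint ∘ suc)))

module _ {n m : ℕ} (D : Digraph n m) where

  full : Subset n
  full = replicate n true

  Bsum≡Z : ∀ (c a b : ℚ) q → pow c m * Bsum D q a b ≡ WeightedColourings.Z D (c * a) c (c * b) full q
  Bsum≡Z c a b q = begin
    pow c m * ∑ (allFuns n q) (λ f → pow a (ascents D f) * pow b (descents D f))
      ≡⟨ ∑-distribˡ (allFuns n q) (pow c m) (λ f → pow a (ascents D f) * pow b (descents D f)) ⟩
    ∑ (allFuns n q) (λ f → pow c m * (pow a (ascents D f) * pow b (descents D f)))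
      ≡⟨ ∑-cong (allFuns n q) (λ f → pow-count c a b m _ _ (λ i → asymmetric (f (tailOf D i)) (f (headOf D i)))) ⟩
    ∑ (allFuns n q) (λ f → ∏ (λ i → weight (f (tailOf D i)) (f (headOf D i))))
      ≡⟨ ∑-allFuns n q _ (λ f≗g → ∏-cong (λ i → cong₂ weight (f≗g (tailOf D i)) (f≗g (headOf D i)))) ⟩
    ∑ᵛ (replicate n (L.allFin q)) (λ v → ∏ (λ i → weight (lookup v (tailOf D i)) (lookup v (headOf D i))))
      ≡⟨ ∑ᵛ-cong (replicate n (L.allFin q)) (λ v → ∏-cong (λ i → sym (cong₂ weightᵐ (lookup-map (tailOf D i) just v) (lookup-map (headOf D i) just v)))) ⟩
    ∑ᵛ (replicate n (L.allFin q)) (λ v → colouringWeight (V.map just v))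
      ≡⟨ sym (∑ᵛ-replicate-map n just (L.allFin q) colouringWeight) ⟩
    ∑ᵛ (replicate n (colours q true)) colouringWeight
      ≡⟨ cong (λ Ls → ∑ᵛ Ls colouringWeight) (sym (map-colours-full n)) ⟩
    Z full q ∎
    where
    open WeightedColourings D (c * a) c (c * b)
    asymmetric : ∀ {q} (x y : Fin q) → does (x FinP.<? y) ≡ true → does (y FinP.<? x) ≡ false
    asymmetric x y = <ᵇ-asym (toℕ x) (toℕ y)
    map-colours-full : ∀ k → V.map (colours q) (replicate k true) ≡ replicate k (colours q true)
    map-colours-full zero    = refl
    map-colours-full (suc k) = cong (colours q true ∷_) (map-colours-full k)

affine-acyclic : ∀ y → AffineOnArcs (topArc y 1ℚ 1ℚ) (bottomArc 1ℚ y y) (1ℚ - y) 0ℚ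
affine-acyclic y {false} {Tt} {_} {false} {Th} _ _ = affine-outside-M _ (both (1ℚ - y) Tt Th) (both 0ℚ Tt Th)
affine-acyclic y inM     inM     = solve 1 (λ y → 𝟙 :* 𝟙 := 𝟙 :* y :+ (𝟙 :- y) :* 𝟙 :+ 𝟘 :* 𝟙) refl y
affine-acyclic y inM     inT     = solve 1 (λ y → 𝟙 :* 𝟙 := 𝟙 :* y :+ (𝟙 :- y) :* 𝟙 :+ 𝟘 :* 𝟘) refl y
affine-acyclic y inM     inU     = solve 1 (λ y → 𝟙 :* 𝟙 := 𝟙 :* 𝟙 :+ 𝟘 :* 𝟙 :+ 𝟘 :* 𝟘) refl y
affine-acyclic y inM     outside = solve 1 (λ y → 𝟙 :* 𝟙 := 𝟙 :* 𝟙 :+ 𝟘 :* 𝟙 :+ 𝟘 :* 𝟘) refl y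
affine-acyclic y inT     inM     = solve 1 (λ y → y :* 𝟙 := 𝟙 :* y :+ (𝟙 :- y) :* 𝟘 :+ 𝟘 :* 𝟙) refl y
affine-acyclic y inU     inM     = solve 1 (λ y → y :* 𝟙 := 𝟙 :* y :+ 𝟘 :* 𝟘 :+ 𝟘 :* 𝟙) refl y
affine-acyclic y outside inM     = solve 1 (λ y → 𝟙 :* 𝟙 := 𝟙 :* 𝟙 :+ 𝟘 :* 𝟘 :+ 𝟘 :* 𝟙) refl y

affine-forest : ∀ y z → AffineOnArcs (topArc y 1ℚ z) (topArc y (y + z - 1ℚ) z) (1ℚ - y) (1ℚ - z)
affine-forest y z {false} {Tt} {_} {false} {Th} _ _ = affine-outside-M _ (both (1ℚ - y) Tt Th) (both (1ℚ - z) Tt Th)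
affine-forest y z inM     inM     = solve 2 (λ y z → 𝟙 :* 𝟙 := 𝟙 :* (y :+ z :- 𝟙) :+ (𝟙 :- y) :* 𝟙 :+ (𝟙 :- z) :* 𝟙) refl y z
affine-forest y z inM     inT     = solve 2 (λ y z → z :* 𝟙 := 𝟙 :* (y :+ z :- 𝟙) :+ (𝟙 :- y) :* 𝟙 :+ (𝟙 :- z) :* 𝟘) refl y z
affine-forest y z inM     inU     = solve 2 (λ y z → z :* 𝟙 := 𝟙 :* z :+ 𝟘 :* 𝟙 :+ 𝟘 :* 𝟘) refl y z
affine-forest y z inM     outside = solve 2 (λ y z → 𝟙 :* 𝟙 := 𝟙 :* 𝟙 :+ 𝟘 :* 𝟙 :+ 𝟘 :* 𝟘) refl y z
affine-forest y z inT     inM     = solve 2 (λ y z → y :* 𝟙 := 𝟙 :* (y :+ z :- 𝟙) :+ (𝟙 :- y) :* 𝟘 :+ (𝟙 :- z) :* 𝟙) refl y z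
affine-forest y z inU     inM     = solve 2 (λ y z → y :* 𝟙 := 𝟙 :* y :+ 𝟘 :* 𝟘 :+ 𝟘 :* 𝟙) refl y z
affine-forest y z outside inM     = solve 2 (λ y z → 𝟙 :* 𝟙 := 𝟙 :* 𝟙 :+ 𝟘 :* 𝟘 :+ 𝟘 :* 𝟙) refl y z

isPolynomial-eval3 : ∀ P y z {f} → IsPolynomial f → IsPolynomial (λ x → eval3 P (f x) y z)
isPolynomial-eval3 []                    y z pf = isPolynomial-const 0ℚ
isPolynomial-eval3 ((c , a , b , e) ∷ P) y z pf = isPolynomial-+
  (isPolynomial-* (isPolynomial-const c) (isPolynomial-* (isPolynomial-pow pf a) (isPolynomial-const (pow y b * pow z e))))
  (isPolynomial-eval3 P y z pf)

module _ {n m : ℕ} (D : Digraph n m) (P : Poly3) (isB : IsBPoly D P) where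

  eval3≡Zpoly : ∀ y z x → eval3 P x y z ≡ Interpolation.Zpoly D y 1ℚ z (full D) x
  eval3≡Zpoly y z = polynomial-identity (isPolynomial-eval3 P y z isPolynomial-id) (isPolynomial-Zpoly (full D)) agree
    where
    open Interpolation D y 1ℚ z
    agree : ∀ k → 1 ≤ k → eval3 P (ℕ→ℚ k) y z ≡ Zpoly (full D) (ℕ→ℚ k)
    agree k k≥1 = begin
      eval3 P (ℕ→ℚ k) y z                                 ≡⟨ isB k k≥1 y z ⟩
      Bsum D k y z                                        ≡⟨ sym (trans (cong (_* Bsum D k y z) (pow-1 m)) (*-identityˡ (Bsum D k y z))) ⟩
      pow 1ℚ m * Bsum D k y z                             ≡⟨ Bsum≡Z D 1ℚ y z k ⟩
      WeightedColourings.Z D (1ℚ * y) 1ℚ (1ℚ * z) (full D) k ≡⟨ cong₂ (λ a b → WeightedColourings.Z D a 1ℚ b (full D) k) (*-identityˡ y) (*-identityˡ z) ⟩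
      WeightedColourings.Z D y 1ℚ z (full D) k           ≡⟨ sym (Zpoly-ℕ k (full D)) ⟩
      Zpoly (full D) (ℕ→ℚ k)                              ∎

  reciprocity-law : ∀ {y z s y′ z′ up′ down′} → up′ ≡ s * y′ → down′ ≡ s * z′ →
    (∀ q → sign (full D) * Interpolation.Zpoly D y 1ℚ z (full D) (- ℕ→ℚ q) ≡ WeightedColourings.Z D up′ s down′ (full D) q) →
    ∀ x → eval3 P (- x) y z ≡ pow (- 1ℚ) n * pow s m * eval3 P x y′ z′
  reciprocity-law {y} {z} {s} {y′} {z′} {up′} {down′} up′≡ down′≡ reciprocal =
    polynomial-identity (isPolynomial-eval3 P y z (isPolynomial-neg isPolynomial-id))
                        (isPolynomial-* (isPolynomial-const (pow (- 1ℚ) n * pow s m)) (isPolynomial-eval3 P y′ z′ isPolynomial-id))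
                        agree
    where
    agree : ∀ k → 1 ≤ k → eval3 P (- ℕ→ℚ k) y z ≡ pow (- 1ℚ) n * pow s m * eval3 P (ℕ→ℚ k) y′ z′
    agree k k≥1 = begin
      eval3 P (- ℕ→ℚ k) y z
        ≡⟨ eval3≡Zpoly y z (- ℕ→ℚ k) ⟩
      Interpolation.Zpoly D y 1ℚ z (full D) (- ℕ→ℚ k)
        ≡⟨ s*e≡w⇒e≡s*w (sign (full D)) _ _ (sign² (full D)) (reciprocal k) ⟩
      sign (full D) * WeightedColourings.Z D up′ s down′ (full D) k
        ≡⟨ cong₂ (λ σ w → σ * w) (sign-full n) (cong₂ (λ a b → WeightedColourings.Z D a s b (full D) k) up′≡ down′≡) ⟩
      pow (- 1ℚ) n * WeightedColourings.Z D (s * y′) s (s * z′) (full D) k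
        ≡⟨ cong (pow (- 1ℚ) n *_) (sym (Bsum≡Z D s y′ z′ k)) ⟩
      pow (- 1ℚ) n * (pow s m * Bsum D k y′ z′)
        ≡⟨ sym (*-assoc (pow (- 1ℚ) n) (pow s m) (Bsum D k y′ z′)) ⟩
      pow (- 1ℚ) n * pow s m * Bsum D k y′ z′
        ≡⟨ cong (pow (- 1ℚ) n * pow s m *_) (sym (isB k k≥1 y′ z′)) ⟩
      pow (- 1ℚ) n * pow s m * eval3 P (ℕ→ℚ k) y′ z′ ∎

  acyclic-reciprocity : Acyclic D → (q y : ℚ) → .{{_ : NonZero y}} →
                        eval3 P (- q) y 1ℚ ≡ pow (- 1ℚ) n * pow y m * eval3 P q (1/ y) 1ℚ
  acyclic-reciprocity acyclic q y = reciprocity-law (sym (*-inverseʳ y)) (sym (*-identityʳ y)) (λ k → reciprocity k (full D)) q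
    where
    open Interpolation D y 1ℚ 1ℚ
    open WeightedColourings D 1ℚ y y using () renaming (Z to Y; bottomFactor to d; Z-zero to Y-zero; Z-suc-bottom to Y-suc)
    open InverseKernel D (topArc y 1ℚ 1ℚ) (bottomArc 1ℚ y y) (1ℚ - y) 0ℚ (affine-acyclic y) (λ _ _ → refl) (λ _ _ → refl)
      (λ T φ v₀ v₀∈T inside 0≢0 → Picks.free-vertex-acyclic D T φ inside v₀ v₀∈T acyclic (λ i picks-head → 0≢0 i picks-head refl))
    open Reciprocity Y d Y-zero Y-suc inverse

  forest-reciprocity : UnderlyingForest D → (q y z : ℚ) → .{{_ : NonZero (y + z - 1ℚ)}} →
                       eval3 P (- q) y z ≡ pow (- 1ℚ) n * pow (y + z - 1ℚ) m * eval3 P q (y ÷ (y + z - 1ℚ)) (z ÷ (y + z - 1ℚ))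
  forest-reciprocity forest q y z = reciprocity-law (sym (s*[p÷s]≡p y)) (sym (s*[p÷s]≡p z)) (λ k → reciprocity k (full D)) q
    where
    s : ℚ
    s = y + z - 1ℚ
    s*[p÷s]≡p : ∀ p → s * (p ÷ s) ≡ p
    s*[p÷s]≡p p = trans (solve 3 (λ s p s⁻¹ → s :* (p :* s⁻¹) := p :* (s⁻¹ :* s)) refl s p (1/ s))
                        (trans (cong (p *_) (*-inverseˡ s)) (*-identityʳ p))
    open Interpolation D y 1ℚ z
    open WeightedColourings D y s z using () renaming (Z to Y; topFactor to d; Z-zero to Y-zero; Z-suc-top to Y-suc)
    open InverseKernel D (topArc y 1ℚ z) (topArc y s z) (1ℚ - y) (1ℚ - z) (affine-forest y z) (λ _ _ → refl) (λ _ _ → refl)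
      (λ T φ v₀ v₀∈T inside _ → Picks.free-vertex-forest D T φ inside v₀ v₀∈T forest)
    open Reciprocity Y d Y-zero Y-suc inverse

theorem6p15 : {n m : ℕ} (D : Digraph n m) (P : Poly3) → IsBPoly D P →
    ((Acyclic D → (q y : ℚ) → .{{_ : NonZero y}} →
        eval3 P (- q) y 1ℚ ≡ pow (- 1ℚ) n * pow y m * eval3 P q (1/ y) 1ℚ)
    × (UnderlyingForest D → (q y z : ℚ) → .{{_ : NonZero (y + z - 1ℚ)}} →
        eval3 P (- q) y z ≡ pow (- 1ℚ) n * pow (y + z - 1ℚ) m
          * eval3 P q (y ÷ (y + z - 1ℚ)) (z ÷ (y + z - 1ℚ))))
theorem6p15 D P isB = acyclic-reciprocity D P isB , forest-reciprocity D P isB
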